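{- For every $n\ge0$, the pairs $(\mathrm{PIX},\mathrm{mag})$ and $(\mathrm{PIX},\mathrm{inv})$ are equidistributed over $\mathfrak S_n$: for every $A\subseteq\{1,\dots,n\}$ and integer $k$, $\#\{\sigma\in\mathfrak S_n:\mathrm{PIX}\,\sigma=A,\ \mathrm{mag}\,\sigma=k\}=\#\{\sigma\in\mathfrak S_n:\mathrm{PIX}\,\sigma=A,\ \mathrm{inv}\,\sigma=k\}$.
   Context: Permutations are words $\sigma(1)\cdots\sigma(n)$. $\mathrm{imaj}\,\sigma=\sum_{i\in\mathrm{DES}\,\sigma^{ -1}}i$ where $\mathrm{DES}\,\pi=\{i:\pi(i)>\pi(i+1)\}$; $\mathrm{inv}\,\sigma=\#\{(i,j):i<j,\ \sigma(i)>\sigma(j)\}$. A word $y_1\cdots y_m$ with distinct letters is a desarrangement if $y_1>\dots>y_{2k}<y_{2k+1}$ for some $k\ge1$ (convention $y_{m+1}=\infty$). Each $\sigma$ factors uniquely as $\sigma^p\sigma^d$ with $\sigma^p$ increasing and $\sigma^d$ the longest right factor of $\sigma$ that is a desarrangement (empty if $\sigma$ is increasing). $\mathrm{PIX}\,\sigma$ = set of letters of $\sigma^p$, $\mathrm{pix}=\#\mathrm{PIX}$; $\mathrm{Desar}\,\sigma\in\mathfrak S_m$ is $\sigma^d$ reduced order-preservingly to $\{1,\dots,m\}$. $\mathrm{mag}\,\sigma=\sum_{i\in\mathrm{PIX}\,\sigma}i-\sum_{i=1}^{\mathrm{pix}\,\sigma}i+\mathrm{imaj}(\mathrm{Desar}\,\sigma)$.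 -}

module Defs where

open import Data.Bool using (Bool; true; false; _∧_; _∨_; not; if_then_else_)
open import Data.Nat using (ℕ; zero; suc; _+_; _*_; _<ᵇ_; _≡ᵇ_; _≤ᵇ_)
open import Data.Nat.Properties using (_≟_)
open import Data.Integer using (ℤ; +_; _-_)
import Data.Integer
open import Data.List using (List; []; _∷_; _++_; map; concatMap; filterᵇ; length; foldr; reverse; applyUpTo)
open import Data.Nat.ListAction using (sum)
open import Relation.Nullary using (yes; no; does)
open import Data.Fin using (Fin; toℕ)
open import Data.Fin.Subset using (Subset)
open import Data.Vec using (tabulate)

-- Words are lists of natural numbers; position i (1-based) holds σ(i).

range1 : ℕ → List ℕ
range1 n = applyUpTo suc n

memᵇ : ℕ → List ℕ → Bool
memᵇ x []       = false
memᵇ x (y ∷ ys) = (x ≡ᵇ y) ∨ memᵇ x ys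

distinctᵇ : List ℕ → Bool
distinctᵇ []       = true
distinctᵇ (x ∷ xs) = not (memᵇ x xs) ∧ distinctᵇ xs

words : ℕ → ℕ → List (List ℕ)
words m zero    = [] ∷ []
words m (suc k) = concatMap (λ w → map (_∷ w) (range1 m)) (words m k)

Sn : ℕ → List (List ℕ)
Sn n = filterᵇ distinctᵇ (words n n)

inv : List ℕ → ℕ
inv []       = 0
inv (x ∷ xs) = length (filterᵇ (λ y → y <ᵇ x) xs) + inv xs

-- 1-based position of letter j in w (only used for letters occurring in w)
pos : ℕ → List ℕ → ℕ
pos j []       = 0
pos j (y ∷ ys) = if j ≡ᵇ y then 1 else suc (pos j ys)

inverse : List ℕ → List ℕ
inverse w = map (λ j → pos j w) (range1 (length w))

desFrom : ℕ → List ℕ → List ℕ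
desFrom i []           = []
desFrom i (x ∷ [])     = []
desFrom i (x ∷ y ∷ ys) = if y <ᵇ x then i ∷ desFrom (suc i) (y ∷ ys) else desFrom (suc i) (y ∷ ys)

DES : List ℕ → List ℕ
DES π = desFrom 1 π

imaj : List ℕ → ℕ
imaj σ = sum (DES (inverse σ))

-- first ascent position of y₁⋯y_m: least i ≥ 1 with y_i < y_{i+1},
-- using the convention y_{m+1} = ∞ (so it is m if there is no ascent); 0 for the empty word.
firstAscent : List ℕ → ℕ
firstAscent []           = 0
firstAscent (x ∷ [])     = 1
firstAscent (x ∷ y ∷ ys) = if x <ᵇ y then 1 else suc (firstAscent (y ∷ ys))

evenᵇ : ℕ → Bool
evenᵇ zero          = true
evenᵇ (suc zero)    = false
evenᵇ (suc (suc n)) = evenᵇ n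

-- y is a desarrangement iff y₁ > ⋯ > y_{2k} < y_{2k+1} for some k ≥ 1
-- (y_{m+1} = ∞), i.e. iff its first ascent is at an even position ≥ 2.
isDesarᵇ : List ℕ → Bool
isDesarᵇ y = evenᵇ (firstAscent y) ∧ (2 ≤ᵇ firstAscent y)

-- σ^d : the longest right factor of σ that is a desarrangement (empty if none)
desPart : List ℕ → List ℕ
desPart []       = []
desPart (x ∷ xs) = if isDesarᵇ (x ∷ xs) then x ∷ xs else desPart xs

pixPart : List ℕ → List ℕ
pixPart []       = []
pixPart (x ∷ xs) = if isDesarᵇ (x ∷ xs) then [] else x ∷ pixPart xs

-- PIX σ as a subset of {1..n} (index i : Fin n stands for the letter i+1)
PIX : (n : ℕ) → List ℕ → Subset n
PIX n σ = tabulate (λ (i : Fin n) → memᵇ (suc (toℕ i)) (pixPart σ))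

pix : List ℕ → ℕ
pix σ = length (pixPart σ)

standardize : List ℕ → List ℕ
standardize w = map (λ x → suc (length (filterᵇ (λ y → y <ᵇ x) w))) w

Desar : List ℕ → List ℕ
Desar σ = standardize (desPart σ)

mag : List ℕ → ℤ
mag σ = (+ sum (pixPart σ)) - (+ sum (range1 (pix σ))) Data.Integer.+ (+ imaj (Desar σ))

subsetEqᵇ : ∀ {n} → Subset n → Subset n → Bool
subsetEqᵇ Data.Vec.[] Data.Vec.[] = true
subsetEqᵇ (a Data.Vec.∷ as) (b Data.Vec.∷ bs) =
  (if a then b else not b) ∧ subsetEqᵇ as bs

intEqᵇ : ℤ → ℤ → Bool
intEqᵇ a b = does (a Data.Integer.≟ b)

count : (n : ℕ) → (List ℕ → ℤ) → Subset n → ℤ → ℕ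
count n stat A k = length (filterᵇ (λ σ → subsetEqᵇ (PIX n σ) A ∧ intEqᵇ (stat σ) k) (Sn n))

invℤ : List ℕ → ℤ
invℤ σ = + inv σ

-- Write σ = σᵖ σᵈ. On the fibre PIX σ = A, σ ↦ Desar σ is a bijection onto the permutations of
-- 1 … m (m = n − |A|) with even first ascent, inverted by relabelling onto the complement of A and
-- prefixing the increasing word A. Along it mag σ = c + imaj (Desar σ) and inv σ = c + inv (Desar σ)
-- with the same constant c = ΣA − (1 + ⋯ + |A|), so it suffices that imaj and inv are equidistributed
-- over the permutations of 1 … m with even first ascent.
--
-- Every permutation of 1 … m+1 arises uniquely from one of 1 … m by appending a last letter p and
-- raising the letters ≥ p by one. As p runs over 1 … m+1, both inv and imaj run over
-- stat π + {0, …, m} (for imaj, the inverse gets m+1 inserted at every position). Appending keeps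
-- first ascent ≥ j for j ≤ m, and for j ≥ m only the decreasing permutation is left, where
-- imaj = inv. Induction on m gives equidistribution over each {first ascent ≥ j}; differences give
-- each exact first ascent, and unions the even ones.

module Submission where

open import Data.Bool using (Bool; true; false; _∧_; not; if_then_else_; T; T?)
open import Data.Bool.Properties using (∧-zeroʳ; ∧-identityʳ; T-∧)
open import Data.Empty using (⊥-elim)
open import Data.Fin using (toℕ; fromℕ<)
import Data.Fin as Fin
open import Data.Fin.Properties using (toℕ-fromℕ<)
open import Data.Fin.Subset using (Subset; ∁)
open import Data.Integer using (ℤ)
import Data.Integer as ℤ
import Data.Integer.Tactic.RingSolver as ℤ-Solver
open import Data.List using (List; []; _∷_; _++_; _∷ʳ_; map; concatMap; filterᵇ; length; applyUpTo; cartesianProductWith)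
open import Data.List.Properties
  using (map-injective; length-++; length-map; length-applyUpTo; map-++; map-∘; map-cong; map-id-local; map-cong-local;
         filter-++; filter-reject; filter-all; filter-none; ∷ʳ-injective; ++-assoc)
open import Data.List.Membership.Propositional using (_∈_; _∉_)
open import Data.List.Membership.Propositional.Properties
  using (∈-++⁺ˡ; ∈-++⁺ʳ; ∈-++⁻; ∈-map⁺; ∈-map⁻; ∈-∃++; ∈-filter⁺; ∈-filter⁻; ∈-cartesianProductWith⁺; ∈-cartesianProductWith⁻)
open import Data.List.Membership.Propositional.Properties.WithK using (unique∧set⇒bag)
open import Data.List.Relation.Binary.BagAndSetEquality using (∼bag⇒↭)
import Data.List.Relation.Binary.Permutation.Propositional as ↭
open import Data.List.Relation.Binary.Permutation.Propositional
  using (_↭_; ↭⇒↭ₛ; ↭-refl; ↭-prep; ↭-swap; ↭-sym; ↭-trans; ↭-reflexive; module PermutationReasoning)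
open import Data.List.Relation.Binary.Permutation.Propositional.Properties
  using (↭-length; ++⁺ˡ; ++⁺ʳ; ++⁺; shifts; drop-∷; ∷↭∷ʳ; ++-comm; ∈-resp-↭; ↭-empty-inv; filter-↭)
  renaming (shift to ↭-shift; map⁺ to map⁺-↭)
open import Data.List.Relation.Unary.All using (All; []; _∷_)
import Data.List.Relation.Unary.All as All
import Data.List.Relation.Unary.All.Properties as All
open import Data.List.Relation.Unary.AllPairs using (AllPairs; []; _∷_)
open import Data.List.Relation.Unary.Any using (here; there)
open import Data.List.Relation.Unary.Unique.Propositional using (Unique)
import Data.List.Relation.Unary.Unique.Propositional.Properties as Unique
open import Data.List.Reverse using (Reverse; reverseView; []; _∶_∶ʳ_)
open import Data.Nat using (ℕ; zero; suc; pred; z<s; s<s; _+_; _*_; _∸_; _≤_; _<_; z≤n; s≤s; _<ᵇ_; _≡ᵇ_; _≤ᵇ_)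
open import Data.Nat.ListAction using (sum)
open import Data.Nat.ListAction.Properties using (sum-++)
open import Data.Nat.Properties
open import Data.Nat.Tactic.RingSolver using (solve-∀)
open import Data.Product using (_×_; _,_; proj₁; proj₂)
open import Data.Sum using (inj₁; inj₂)
open import Data.Vec using ([]; _∷_; tabulate; lookup)
open import Data.Vec.Properties using (tabulate-cong; lookup∘tabulate)
open import Function using (_∘_; flip; mk⇔)
open import Function.Bundles using (Equivalence)
open import Relation.Binary.Definitions using (tri<; tri≈; tri>)
open import Relation.Binary.PropositionalEquality
  using (_≡_; _≢_; refl; sym; trans; cong; cong₂; subst; ≢-sym; setoid; module ≡-Reasoning)
open import Relation.Nullary using (¬_; contradiction; yes; no)
open import Relation.Nullary.Reflects using (ofʸ; ofⁿ)

open import Defs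

private
  variable
    A B C : Set
    m n : ℕ

T⇒≡true : ∀ {b} → T b → b ≡ true
T⇒≡true {true} _ = refl

≡true⇒T : ∀ {b} → b ≡ true → T b
≡true⇒T refl = _

<⇒<ᵇ≡true : m < n → (m <ᵇ n) ≡ true
<⇒<ᵇ≡true {m} {n} m<n with m <ᵇ n | <ᵇ-reflects-< m n
... | true  | _       = refl
... | false | ofⁿ m≮n = ⊥-elim (m≮n m<n)

≥⇒<ᵇ≡false : n ≤ m → (m <ᵇ n) ≡ false
≥⇒<ᵇ≡false {n} {m} n≤m with m <ᵇ n | <ᵇ-reflects-< m n
... | false | _       = refl
... | true  | ofʸ m<n = ⊥-elim (<⇒≱ m<n n≤m)

≤⇒≤ᵇ≡true : m ≤ n → (m ≤ᵇ n) ≡ true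
≤⇒≤ᵇ≡true z≤n       = refl
≤⇒≤ᵇ≡true (s≤s m≤n) = <⇒<ᵇ≡true (s≤s m≤n)

>⇒≤ᵇ≡false : n < m → (m ≤ᵇ n) ≡ false
>⇒≤ᵇ≡false {m = suc m} (s≤s n≤m) = ≥⇒<ᵇ≡false n≤m

≡ᵇ-refl : ∀ n → (n ≡ᵇ n) ≡ true
≡ᵇ-refl zero    = refl
≡ᵇ-refl (suc n) = ≡ᵇ-refl n

≢⇒≡ᵇ≡false : m ≢ n → (m ≡ᵇ n) ≡ false
≢⇒≡ᵇ≡false {m} {n} m≢n with m ≡ᵇ n in eq
... | false = refl
... | true  = ⊥-elim (m≢n (≡ᵇ⇒≡ m n (subst T (sym eq) _)))

injective-≡ᵇ : ∀ {f : ℕ → ℕ} → (∀ {a b} → f a ≡ f b → a ≡ b) →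
  ∀ a b → (f a ≡ᵇ f b) ≡ (a ≡ᵇ b)
injective-≡ᵇ {f} f-inj a b with a ≡ᵇ b in a≡ᵇb
... | true  rewrite ≡ᵇ⇒≡ a b (≡true⇒T a≡ᵇb) = ≡ᵇ-refl (f b)
... | false = ≢⇒≡ᵇ≡false (λ fa≡fb → subst T a≡ᵇb (≡⇒≡ᵇ a b (f-inj fa≡fb)))

evenᵇ-suc : ∀ k → evenᵇ (suc k) ≡ not (evenᵇ k)
evenᵇ-suc zero          = refl
evenᵇ-suc (suc zero)    = refl
evenᵇ-suc (suc (suc k)) = evenᵇ-suc k

≤ᵇ-∧-≡ᵇ : ∀ j k → ((j ≤ᵇ k) ∧ (k ≡ᵇ j)) ≡ (k ≡ᵇ j)
≤ᵇ-∧-≡ᵇ j k with <-cmp k j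
... | tri< k<j _ _ rewrite >⇒≤ᵇ≡false k<j | ≢⇒≡ᵇ≡false (<⇒≢ k<j) = refl
... | tri≈ _ refl _ rewrite ≤⇒≤ᵇ≡true (≤-refl {k}) | ≡ᵇ-refl k = refl
... | tri> _ _ j<k rewrite ≤⇒≤ᵇ≡true (<⇒≤ j<k) | ≢⇒≡ᵇ≡false (≢-sym (<⇒≢ j<k)) = refl

≤ᵇ-∧-≢ᵇ : ∀ j k → ((j ≤ᵇ k) ∧ not (k ≡ᵇ j)) ≡ (suc j ≤ᵇ k)
≤ᵇ-∧-≢ᵇ j k with <-cmp k j
... | tri< k<j _ _ rewrite >⇒≤ᵇ≡false k<j | >⇒≤ᵇ≡false (m<n⇒m<1+n k<j) = refl
... | tri≈ _ refl _ rewrite ≤⇒≤ᵇ≡true (≤-refl {k}) | ≡ᵇ-refl k | >⇒≤ᵇ≡false (n<1+n k) = refl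
... | tri> _ _ j<k
  rewrite ≤⇒≤ᵇ≡true (<⇒≤ j<k) | ≢⇒≡ᵇ≡false (≢-sym (<⇒≢ j<k)) | ≤⇒≤ᵇ≡true j<k = refl

≤ᵇ-∧-∧-≡ᵇ : ∀ (Q : ℕ → Bool) j k →
  (((j ≤ᵇ k) ∧ Q k) ∧ (k ≡ᵇ j)) ≡ (Q j ∧ (k ≡ᵇ j))
≤ᵇ-∧-∧-≡ᵇ Q j k with <-cmp k j
... | tri< k<j _ _ rewrite >⇒≤ᵇ≡false k<j | ≢⇒≡ᵇ≡false (<⇒≢ k<j) = sym (∧-zeroʳ (Q j))
... | tri≈ _ refl _ rewrite ≤⇒≤ᵇ≡true (≤-refl {k}) = refl
... | tri> _ _ j<k rewrite ≤⇒≤ᵇ≡true (<⇒≤ j<k) | ≢⇒≡ᵇ≡false (≢-sym (<⇒≢ j<k)) =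
  trans (∧-zeroʳ (Q k)) (sym (∧-zeroʳ (Q j)))

≤ᵇ-∧-∧-≢ᵇ : ∀ (Q : ℕ → Bool) j k →
  (((j ≤ᵇ k) ∧ Q k) ∧ not (k ≡ᵇ j)) ≡ ((suc j ≤ᵇ k) ∧ Q k)
≤ᵇ-∧-∧-≢ᵇ Q j k with <-cmp k j
... | tri< k<j _ _ rewrite >⇒≤ᵇ≡false k<j | >⇒≤ᵇ≡false (m<n⇒m<1+n k<j) = refl
... | tri≈ _ refl _ rewrite ≤⇒≤ᵇ≡true (≤-refl {k}) | ≡ᵇ-refl k | >⇒≤ᵇ≡false (n<1+n k) =
  ∧-zeroʳ (Q k)
... | tri> _ _ j<k
  rewrite ≤⇒≤ᵇ≡true (<⇒≤ j<k) | ≢⇒≡ᵇ≡false (≢-sym (<⇒≢ j<k)) | ≤⇒≤ᵇ≡true j<k =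
  ∧-identityʳ (Q k)

filterᵇ-split : ∀ (p b : A → Bool) xs →
  filterᵇ p xs ↭ filterᵇ (λ x → p x ∧ b x) xs ++ filterᵇ (λ x → p x ∧ not (b x)) xs
filterᵇ-split p b []       = ↭-refl
filterᵇ-split p b (x ∷ xs) with p x | b x
... | false | _     = filterᵇ-split p b xs
... | true  | true  = ↭-prep x (filterᵇ-split p b xs)
... | true  | false = ↭-trans (↭-prep x (filterᵇ-split p b xs)) (↭-sym (↭-shift x _ _))

filterᵇ-cong : ∀ {p q : A → Bool} xs → (∀ {x} → x ∈ xs → p x ≡ q x) → filterᵇ p xs ≡ filterᵇ q xs
filterᵇ-cong []       p≗q = refl
filterᵇ-cong {p = p} {q} (x ∷ xs) p≗q with p x | q x | p≗q (here refl)
... | true  | true  | _ = cong (x ∷_) (filterᵇ-cong xs (p≗q ∘ there))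
... | false | false | _ = filterᵇ-cong xs (p≗q ∘ there)

filterᵇ-map : ∀ (p : B → Bool) (f : A → B) xs → filterᵇ p (map f xs) ≡ map f (filterᵇ (p ∘ f) xs)
filterᵇ-map p f []       = refl
filterᵇ-map p f (x ∷ xs) with p (f x)
... | true  = cong (f x ∷_) (filterᵇ-map p f xs)
... | false = filterᵇ-map p f xs

++-cancelˡ-↭ : ∀ (xs : List A) {ys zs} → xs ++ ys ↭ xs ++ zs → ys ↭ zs
++-cancelˡ-↭ []       ys↭zs = ys↭zs
++-cancelˡ-↭ (x ∷ xs) ys↭zs = ++-cancelˡ-↭ xs (drop-∷ ys↭zs)

↭-unique : ∀ {xs ys : List A} → xs ↭ ys → Unique xs → Unique ys
↭-unique xs↭ys = PermSetoid.Unique-resp-↭ (↭⇒↭ₛ xs↭ys)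
  where import Data.List.Relation.Binary.Permutation.Setoid.Properties (setoid _) as PermSetoid

map-unique : ∀ {f : A → B} {xs} → (∀ {x y} → x ∈ xs → y ∈ xs → f x ≡ f y → x ≡ y) →
  Unique xs → Unique (map f xs)
map-unique f-inj []              = []
map-unique f-inj (x∉xs ∷ xs-uniq) =
  All.map⁺ (All.tabulate λ y∈ fx≡fy → All.lookup x∉xs y∈ (f-inj (here refl) (there y∈) fx≡fy))
  ∷ map-unique (λ x∈ y∈ → f-inj (there x∈) (there y∈)) xs-uniq

∈-++-∷-≢ : ∀ {x y : A} ys zs → y ∈ ys ++ x ∷ zs → y ≢ x → y ∈ ys ++ zs
∈-++-∷-≢ ys zs y∈ y≢x with ∈-++⁻ ys y∈
... | inj₁ y∈ys         = ∈-++⁺ˡ y∈ys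
... | inj₂ (here y≡x)   = ⊥-elim (y≢x y≡x)
... | inj₂ (there y∈zs) = ∈-++⁺ʳ ys y∈zs

unique-⊆-↭ : ∀ {xs ys : List A} → Unique xs → (∀ {x} → x ∈ xs → x ∈ ys) →
  length xs ≡ length ys → xs ↭ ys
unique-⊆-↭ {xs = []}     {[]} _ _ _ = ↭-refl
unique-⊆-↭ {xs = x ∷ xs} (x∉xs ∷ xs-uniq) xs⊆ys |xs|≡|ys|
  with ys₁ , ys₂ , refl ← ∈-∃++ (xs⊆ys (here refl)) =
  ↭-trans (↭-prep x (unique-⊆-↭ xs-uniq xs⊆ys₁ys₂ |xs|≡|ys₁ys₂|)) (↭-sym (↭-shift x ys₁ ys₂))
  where
  xs⊆ys₁ys₂ : ∀ {y} → y ∈ xs → y ∈ ys₁ ++ ys₂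
  xs⊆ys₁ys₂ y∈ = ∈-++-∷-≢ ys₁ ys₂ (xs⊆ys (there y∈)) (≢-sym (All.lookup x∉xs y∈))
  |xs|≡|ys₁ys₂| : length xs ≡ length (ys₁ ++ ys₂)
  |xs|≡|ys₁ys₂| = suc-injective (trans |xs|≡|ys| (↭-length (↭-shift x ys₁ ys₂)))

length-≡-by-inverses : ∀ {xs : List A} {ys : List B} (f : A → B) (g : B → A) →
  Unique xs → Unique ys →
  (∀ {x} → x ∈ xs → f x ∈ ys) → (∀ {y} → y ∈ ys → g y ∈ xs) →
  (∀ {x} → x ∈ xs → g (f x) ≡ x) → (∀ {y} → y ∈ ys → f (g y) ≡ y) →
  length xs ≡ length ys
length-≡-by-inverses {xs = xs} {ys} f g xs-uniq ys-uniq f∈ g∈ gf fg =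
  trans (sym (length-map f xs)) (↭-length (∼bag⇒↭ (unique∧set⇒bag fxs-uniq ys-uniq (mk⇔ to from))))
  where
  fxs-uniq : Unique (map f xs)
  fxs-uniq = map-unique (λ x∈ y∈ fx≡fy → trans (sym (gf x∈)) (trans (cong g fx≡fy) (gf y∈))) xs-uniq
  to : ∀ {y} → y ∈ map f xs → y ∈ ys
  to y∈ with x , x∈ , refl ← ∈-map⁻ f y∈ = f∈ x∈
  from : ∀ {y} → y ∈ ys → y ∈ map f xs
  from y∈ = subst (_∈ map f xs) (fg y∈) (∈-map⁺ f (g∈ y∈))

concatMap-↭ : ∀ (h : A → List B) {xs ys} → xs ↭ ys → concatMap h xs ↭ concatMap h ys
concatMap-↭ h ↭.refl          = ↭-refl
concatMap-↭ h (↭.prep x p)    = ++⁺ˡ (h x) (concatMap-↭ h p)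
concatMap-↭ h (↭.swap x y p)  = ↭-trans (shifts (h x) (h y)) (++⁺ˡ (h y) (++⁺ˡ (h x) (concatMap-↭ h p)))
concatMap-↭ h (↭.trans p p′)  = ↭-trans (concatMap-↭ h p) (concatMap-↭ h p′)

concatMap-map≡cartesianProductWith : ∀ (f : A → B → C) xs ys →
  concatMap (λ x → map (f x) ys) xs ≡ cartesianProductWith f xs ys
concatMap-map≡cartesianProductWith f []       ys = refl
concatMap-map≡cartesianProductWith f (x ∷ xs) ys =
  cong (map (f x) ys ++_) (concatMap-map≡cartesianProductWith f xs ys)

filterᵇ-cartesianProductWith : ∀ (f : A → B → C) {q : C → Bool} {r : A → Bool} xs ys →
  (∀ {x y} → x ∈ xs → q (f x y) ≡ r x) →
  filterᵇ q (cartesianProductWith f xs ys) ≡ cartesianProductWith f (filterᵇ r xs) ys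
filterᵇ-cartesianProductWith f []       ys q≡r = refl
filterᵇ-cartesianProductWith f {q} {r} (x ∷ xs) ys q≡r
  with r x in rx | filterᵇ-cartesianProductWith f xs ys (q≡r ∘ there)
... | true  | ih = trans (filter-++ (T? ∘ q) (map (f x) ys) _) (cong₂ _++_ row ih)
  where
  row : filterᵇ q (map (f x) ys) ≡ map (f x) ys
  row = filter-all (T? ∘ q) (All.map⁺ (All.universal (λ _ → ≡true⇒T (trans (q≡r (here refl)) rx)) ys))
... | false | ih = trans (filter-++ (T? ∘ q) (map (f x) ys) _) (trans (cong (_++ _) row) ih)
  where
  row : filterᵇ q (map (f x) ys) ≡ []
  row = filter-none (T? ∘ q) (All.map⁺ (All.universal (λ _ → subst T (trans (q≡r (here refl)) rx)) ys))

map-cartesianProductWith-↭ : ∀ (f : A → B → C) (g : C → ℕ) (s : A → ℕ) (h : ℕ → List ℕ) xs ys →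
  (∀ {x} → x ∈ xs → map (g ∘ f x) ys ↭ h (s x)) →
  map g (cartesianProductWith f xs ys) ↭ concatMap h (map s xs)
map-cartesianProductWith-↭ f g s h []       ys rows = ↭-refl
map-cartesianProductWith-↭ f g s h (x ∷ xs) ys rows =
  ↭-trans (↭-reflexive (trans (map-++ g (map (f x) ys) _) (cong (_++ _) (sym (map-∘ ys)))))
    (++⁺ (rows (here refl)) (map-cartesianProductWith-↭ f g s h xs ys (rows ∘ there)))

length-∷ʳ : ∀ (xs : List A) a → length (xs ∷ʳ a) ≡ suc (length xs)
length-∷ʳ xs a = trans (length-++ xs) (+-comm (length xs) 1)

insertAt : ℕ → A → List A → List A
insertAt zero    y xs       = y ∷ xs
insertAt (suc k) y []       = y ∷ []
insertAt (suc k) y (x ∷ xs) = x ∷ insertAt k y xs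

insertAt-↭ : ∀ k (y : A) xs → insertAt k y xs ↭ y ∷ xs
insertAt-↭ zero    y xs       = ↭-refl
insertAt-↭ (suc k) y []       = ↭-refl
insertAt-↭ (suc k) y (x ∷ xs) = ↭-trans (↭-prep x (insertAt-↭ k y xs)) (↭-swap x y ↭-refl)

map-insertAt : ∀ (f : A → B) k y xs → map f (insertAt k y xs) ≡ insertAt k (f y) (map f xs)
map-insertAt f zero    y xs       = refl
map-insertAt f (suc k) y []       = refl
map-insertAt f (suc k) y (x ∷ xs) = cong (f x ∷_) (map-insertAt f k y xs)

insertAt-∷ʳ : ∀ k (y : A) xs a → k ≤ length xs → insertAt k y (xs ∷ʳ a) ≡ insertAt k y xs ∷ʳ a
insertAt-∷ʳ zero    y xs       a _         = refl
insertAt-∷ʳ (suc k) y (x ∷ xs) a (s≤s k≤) = cong (x ∷_) (insertAt-∷ʳ k y xs a k≤)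

insertAt-length : ∀ (y : A) xs → insertAt (length xs) y xs ≡ xs ∷ʳ y
insertAt-length y []       = refl
insertAt-length y (x ∷ xs) = cong (x ∷_) (insertAt-length y xs)

length-insertAt : ∀ k (y : A) xs → length (insertAt k y xs) ≡ suc (length xs)
length-insertAt zero    y xs       = refl
length-insertAt (suc k) y []       = refl
length-insertAt (suc k) y (x ∷ xs) = cong (suc) (length-insertAt k y xs)

sum-map-+ : ∀ (f g : ℕ → ℕ) xs → sum (map (λ a → f a + g a) xs) ≡ sum (map f xs) + sum (map g xs)
sum-map-+ f g []       = refl
sum-map-+ f g (x ∷ xs) rewrite sum-map-+ f g xs = +-+-interchange (f x) (g x) (sum (map f xs)) (sum (map g xs))
  where
  +-+-interchange : ∀ a b c d → a + b + (c + d) ≡ a + c + (b + d)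
  +-+-interchange = solve-∀

interval : ℕ → ℕ → List ℕ
interval a zero    = []
interval a (suc n) = a ∷ interval (suc a) n

applyUpTo-interval : ∀ (f : ℕ → ℕ) a n → (∀ i → f i ≡ a + i) → applyUpTo f n ≡ interval a n
applyUpTo-interval f a zero    f≗a+ = refl
applyUpTo-interval f a (suc n) f≗a+ = cong₂ _∷_ (trans (f≗a+ 0) (+-identityʳ a))
  (applyUpTo-interval (f ∘ suc) (suc a) n (λ i → trans (f≗a+ (suc i)) (+-suc a i)))

range1≡interval : ∀ n → range1 n ≡ interval 1 n
range1≡interval n = applyUpTo-interval suc 1 n (λ _ → refl)

length-interval : ∀ a n → length (interval a n) ≡ n
length-interval a zero    = refl
length-interval a (suc n) = cong suc (length-interval (suc a) n)

interval-∷ʳ : ∀ a n → interval a (suc n) ≡ interval a n ∷ʳ (a + n)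
interval-∷ʳ a zero    = cong (_∷ []) (sym (+-identityʳ a))
interval-∷ʳ a (suc n) =
  cong (a ∷_) (trans (interval-∷ʳ (suc a) n) (cong (interval (suc a) n ∷ʳ_) (sym (+-suc a n))))

map-+-interval : ∀ c a n → map (c +_) (interval a n) ≡ interval (c + a) n
map-+-interval c a zero    = refl
map-+-interval c a (suc n) =
  cong (c + a ∷_) (trans (map-+-interval c (suc a) n) (cong (λ b → interval b n) (+-suc c a)))

interval-2≡map-suc : ∀ n → interval 2 n ≡ map suc (interval 1 n)
interval-2≡map-suc n = sym (map-+-interval 1 1 n)

map-pred-interval : ∀ a n → map pred (interval (suc a) n) ≡ interval a n
map-pred-interval a zero    = refl
map-pred-interval a (suc n) = cong (a ∷_) (map-pred-interval (suc a) n)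

∈-interval⁻ : ∀ {x} a n → x ∈ interval a n → a ≤ x × x < a + n
∈-interval⁻ a (suc n) (here refl) = ≤-refl , m<m+n a z<s
∈-interval⁻ {x} a (suc n) (there x∈) with a<x , x<a+n ← ∈-interval⁻ (suc a) n x∈ =
  <⇒≤ a<x , subst (x <_) (sym (+-suc a n)) x<a+n

interval-unique : ∀ a n → Unique (interval a n)
interval-unique a zero    = []
interval-unique a (suc n) =
  All.tabulate (λ x∈ → <⇒≢ (proj₁ (∈-interval⁻ (suc a) n x∈))) ∷ interval-unique (suc a) n

map-reflect-interval : ∀ v K → map (λ p → v + (K ∸ p)) (interval 1 K) ↭ interval v K
map-reflect-interval v zero    = ↭-refl
map-reflect-interval v (suc K) = begin
  v + K ∷ map f (interval 2 K)                     ≡⟨ cong (λ w → v + K ∷ map f w) (interval-2≡map-suc K) ⟩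
  v + K ∷ map f (map suc (interval 1 K))           ≡⟨ cong (v + K ∷_) (map-∘ (interval 1 K)) ⟨
  v + K ∷ map (λ p → v + (K ∸ p)) (interval 1 K)   ↭⟨ ↭-prep (v + K) (map-reflect-interval v K) ⟩
  v + K ∷ interval v K                             ↭⟨ ∷↭∷ʳ (v + K) (interval v K) ⟩
  interval v K ∷ʳ (v + K)                          ≡⟨ interval-∷ʳ v K ⟨
  interval v (suc K)                               ∎
  where
  open PermutationReasoning
  f = λ p → v + (suc K ∸ p)

-- Equidistribution of two statistics

Equidistributed : (A → ℕ) → (A → ℕ) → List A → Set
Equidistributed f g xs = map f xs ↭ map g xs

Equidistributed-↭ : ∀ {f g : A → ℕ} {xs ys} →
  xs ↭ ys → Equidistributed f g xs → Equidistributed f g ys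
Equidistributed-↭ {f = f} {g} xs↭ys eq = ↭-trans (map⁺-↭ f (↭-sym xs↭ys)) (↭-trans eq (map⁺-↭ g xs↭ys))

Equidistributed-++ : ∀ {f g : A → ℕ} {xs ys} →
  Equidistributed f g xs → Equidistributed f g ys → Equidistributed f g (xs ++ ys)
Equidistributed-++ {f = f} {g} {xs} {ys} eq eq′ =
  ↭-trans (↭-reflexive (map-++ f xs ys)) (↭-trans (++⁺ eq eq′) (↭-reflexive (sym (map-++ g xs ys))))

Equidistributed-cancelʳ : ∀ {f g : A → ℕ} xs ys → Equidistributed f g (xs ++ ys) → Equidistributed f g ys →
  Equidistributed f g xs
Equidistributed-cancelʳ {f = f} {g} xs ys eq eq′ = ++-cancelˡ-↭ (map g ys) (begin
  map g ys ++ map f xs   ↭⟨ ++⁺ʳ _ eq′ ⟨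
  map f ys ++ map f xs   ↭⟨ ++-comm (map f ys) (map f xs) ⟩
  map f xs ++ map f ys   ≡⟨ map-++ f xs ys ⟨
  map f (xs ++ ys)       ↭⟨ eq ⟩
  map g (xs ++ ys)       ≡⟨ map-++ g xs ys ⟩
  map g xs ++ map g ys   ↭⟨ ++-comm (map g xs) (map g ys) ⟩
  map g ys ++ map g xs   ∎)
  where open PermutationReasoning

module _ {A : Set} (κ : A → ℕ) {f g : A → ℕ} {xs : List A}
         (tails : ∀ j → Equidistributed f g (filterᵇ (λ x → j ≤ᵇ κ x) xs)) where

  private
    split : ∀ {p q r : A → Bool} b → (∀ x → (p x ∧ b x) ≡ q x) → (∀ x → (p x ∧ not (b x)) ≡ r x) →
      filterᵇ p xs ↭ filterᵇ q xs ++ filterᵇ r xs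
    split b q≗ r≗ = ↭-trans (filterᵇ-split _ b xs)
      (↭-reflexive (cong₂ _++_ (filterᵇ-cong xs (λ {x} _ → q≗ x)) (filterᵇ-cong xs (λ {x} _ → r≗ x))))

    empty : ∀ {p : A → Bool} → (∀ {x} → x ∈ xs → p x ≡ false) → Equidistributed f g (filterᵇ p xs)
    empty p≡false = subst (Equidistributed f g) (sym (filter-none _ (All.tabulate (subst T ∘ p≡false)))) ↭-refl

  equidistributed-fibers : ∀ j → Equidistributed f g (filterᵇ (λ x → κ x ≡ᵇ j) xs)
  equidistributed-fibers j = Equidistributed-cancelʳ _ (filterᵇ (λ x → suc j ≤ᵇ κ x) xs)
    (Equidistributed-↭ (split (λ x → κ x ≡ᵇ j) (≤ᵇ-∧-≡ᵇ j ∘ κ) (≤ᵇ-∧-≢ᵇ j ∘ κ)) (tails j))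
    (tails (suc j))

  equidistributed-classes-from : ∀ (Q : ℕ → Bool) d j → (∀ {x} → x ∈ xs → κ x < j + d) →
    Equidistributed f g (filterᵇ (λ x → (j ≤ᵇ κ x) ∧ Q (κ x)) xs)
  equidistributed-classes-from Q zero    j κ< =
    empty λ {x} x∈ → cong (_∧ Q (κ x)) (>⇒≤ᵇ≡false (subst (κ x <_) (+-identityʳ j) (κ< x∈)))
  equidistributed-classes-from Q (suc d) j κ< =
    Equidistributed-↭
      (↭-sym (split (λ x → κ x ≡ᵇ j) (≤ᵇ-∧-∧-≡ᵇ Q j ∘ κ) (≤ᵇ-∧-∧-≢ᵇ Q j ∘ κ)))
      (Equidistributed-++ (fiber (Q j))
        (equidistributed-classes-from Q d (suc j) (λ {x} x∈ → subst (κ x <_) (+-suc j d) (κ< x∈))))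
    where
    fiber : ∀ b → Equidistributed f g (filterᵇ (λ x → b ∧ (κ x ≡ᵇ j)) xs)
    fiber true  = equidistributed-fibers j
    fiber false = empty (λ _ → refl)

  equidistributed-classes : ∀ (Q : ℕ → Bool) N → (∀ {x} → x ∈ xs → κ x < N) →
    Equidistributed f g (filterᵇ (λ x → Q (κ x)) xs)
  equidistributed-classes Q N = equidistributed-classes-from Q N 0

memᵇ⇒∈ : ∀ {x} xs → memᵇ x xs ≡ true → x ∈ xs
memᵇ⇒∈ {x} (y ∷ ys) eq with x ≡ᵇ y in x≡ᵇy
... | true  = here (≡ᵇ⇒≡ x y (≡true⇒T x≡ᵇy))
... | false = there (memᵇ⇒∈ ys eq)

∈⇒memᵇ : ∀ {x xs} → x ∈ xs → memᵇ x xs ≡ true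
∈⇒memᵇ {x} (here refl) rewrite ≡ᵇ-refl x = refl
∈⇒memᵇ {x} {y ∷ _} (there x∈) with x ≡ᵇ y
... | true  = refl
... | false = ∈⇒memᵇ x∈

∉⇒memᵇ : ∀ {x} xs → x ∉ xs → memᵇ x xs ≡ false
∉⇒memᵇ {x} xs x∉ with memᵇ x xs in eq
... | false = refl
... | true  = ⊥-elim (x∉ (memᵇ⇒∈ xs eq))

distinctᵇ⇒unique : ∀ xs → T (distinctᵇ xs) → Unique xs
distinctᵇ⇒unique []       _ = []
distinctᵇ⇒unique (x ∷ xs) t with memᵇ x xs in eq
... | false = All.¬Any⇒All¬ xs (λ x∈ → subst T eq (≡true⇒T (∈⇒memᵇ x∈))) ∷ distinctᵇ⇒unique xs t

unique⇒distinctᵇ : ∀ {xs} → Unique xs → T (distinctᵇ xs)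
unique⇒distinctᵇ []                         = _
unique⇒distinctᵇ {x ∷ xs} (x∉xs ∷ xs-uniq) rewrite ∉⇒memᵇ xs (All.All¬⇒¬Any x∉xs) =
  unique⇒distinctᵇ xs-uniq

∈-words⁻ : ∀ m k {σ} → σ ∈ words m k → length σ ≡ k × (∀ {x} → x ∈ σ → x ∈ range1 m)
∈-words⁻ m zero    (here refl) = refl , λ ()
∈-words⁻ m (suc k) σ∈
  with w , x , w∈ , x∈ , refl ← ∈-cartesianProductWith⁻ (flip _∷_) (words m k) (range1 m)
         (subst (_ ∈_) (concatMap-map≡cartesianProductWith (flip _∷_) (words m k) (range1 m)) σ∈)
  with |w|≡k , w⊆ ← ∈-words⁻ m k w∈ =
  cong suc |w|≡k , λ { (here refl) → x∈ ; (there y∈) → w⊆ y∈ }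

∈-words⁺ : ∀ m σ → (∀ {x} → x ∈ σ → x ∈ range1 m) → σ ∈ words m (length σ)
∈-words⁺ m []      _  = here refl
∈-words⁺ m (x ∷ σ) σ⊆ =
  subst (_ ∈_) (sym (concatMap-map≡cartesianProductWith (flip _∷_) (words m (length σ)) (range1 m)))
    (∈-cartesianProductWith⁺ (flip _∷_) (∈-words⁺ m σ (σ⊆ ∘ there)) (σ⊆ (here refl)))

IsPerm : ℕ → List ℕ → Set
IsPerm n σ = σ ↭ interval 1 n

IsPerm-unique : ∀ {σ} → IsPerm n σ → Unique σ
IsPerm-unique σ↭ = ↭-unique (↭-sym σ↭) (interval-unique 1 _)

IsPerm-length : ∀ {σ} → IsPerm n σ → length σ ≡ n
IsPerm-length σ↭ = trans (↭-length σ↭) (length-interval 1 _)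

IsPerm-∈ : ∀ {σ x} → IsPerm n σ → x ∈ σ → 1 ≤ x × x ≤ n
IsPerm-∈ σ↭ x∈ with 1≤x , x<1+n ← ∈-interval⁻ 1 _ (∈-resp-↭ σ↭ x∈) = 1≤x , ≤-pred x<1+n

Sn⇒IsPerm : ∀ n {σ} → σ ∈ Sn n → IsPerm n σ
Sn⇒IsPerm n {σ} σ∈ with σ∈words , distinct ← ∈-filter⁻ (T? ∘ distinctᵇ) σ∈
  with |σ|≡n , σ⊆ ← ∈-words⁻ n n σ∈words =
  unique-⊆-↭ (distinctᵇ⇒unique σ distinct) (subst (_ ∈_) (range1≡interval n) ∘ σ⊆)
    (trans |σ|≡n (sym (length-interval 1 n)))

IsPerm⇒Sn : ∀ n {σ} → IsPerm n σ → σ ∈ Sn n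
IsPerm⇒Sn n {σ} σ↭ = ∈-filter⁺ (T? ∘ distinctᵇ)
  (subst (λ k → σ ∈ words n k) (IsPerm-length σ↭)
    (∈-words⁺ n σ (subst (_ ∈_) (sym (range1≡interval n)) ∘ ∈-resp-↭ σ↭)))
  (unique⇒distinctᵇ (IsPerm-unique σ↭))

Sn-unique : ∀ n → Unique (Sn n)
Sn-unique n = Unique.filter⁺ (T? ∘ distinctᵇ) (words-unique n)
  where
  words-unique : ∀ k → Unique (words n k)
  words-unique zero    = [] ∷ []
  words-unique (suc k) = subst Unique (sym (concatMap-map≡cartesianProductWith (flip _∷_) (words n k) (range1 n)))
    (Unique.cartesianProductWith⁺ (flip _∷_) (λ { refl → refl , refl }) (words-unique k)
      (subst Unique (sym (range1≡interval n)) (interval-unique 1 n)))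

-- Appending a last letter

shift : ℕ → ℕ → ℕ
shift p x = if x <ᵇ p then x else suc x

unshift : ℕ → ℕ → ℕ
unshift p x = if x <ᵇ p then x else pred x

shift-< : ∀ {p x} → x < p → shift p x ≡ x
shift-< x<p rewrite <⇒<ᵇ≡true x<p = refl

shift-≥ : ∀ {p x} → p ≤ x → shift p x ≡ suc x
shift-≥ p≤x rewrite ≥⇒<ᵇ≡false p≤x = refl

shift-monotone : ∀ p {x y} → x < y → shift p x < shift p y
shift-monotone p {x} {y} x<y with x <ᵇ p | <ᵇ-reflects-< x p | y <ᵇ p | <ᵇ-reflects-< y p
... | true  | _       | true  | _       = x<y
... | true  | _       | false | _       = m<n⇒m<1+n x<y
... | false | ofⁿ x≮p | true  | ofʸ y<p = ⊥-elim (x≮p (<-trans x<y y<p))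
... | false | _       | false | _       = s<s x<y

shift-injective : ∀ p {x y} → shift p x ≡ shift p y → x ≡ y
shift-injective p {x} {y} eq with <-cmp x y
... | tri≈ _ x≡y _ = x≡y
... | tri< x<y _ _ = ⊥-elim (<-irrefl eq (shift-monotone p x<y))
... | tri> _ _ y<x = ⊥-elim (<-irrefl (sym eq) (shift-monotone p y<x))

shift-≢ : ∀ p x → shift p x ≢ p
shift-≢ p x with x <ᵇ p | <ᵇ-reflects-< x p
... | true  | ofʸ x<p = <⇒≢ x<p
... | false | ofⁿ x≮p = λ { refl → x≮p ≤-refl }

unshift-shift : ∀ p x → unshift p (shift p x) ≡ x
unshift-shift p x with x <ᵇ p in x<ᵇp | <ᵇ-reflects-< x p
... | true  | _       rewrite x<ᵇp = refl
... | false | ofⁿ x≮p rewrite ≥⇒<ᵇ≡false {p} {suc x} (m≤n⇒m≤1+n (≮⇒≥ x≮p)) = refl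

shift-unshift : ∀ p x → x ≢ p → shift p (unshift p x) ≡ x
shift-unshift p x x≢p with x <ᵇ p | <ᵇ-reflects-< x p
... | true  | ofʸ x<p = shift-< x<p
shift-unshift p (suc x) x≢p | false | ofⁿ x≮p = shift-≥ (≤-pred (≤∧≢⇒< (≮⇒≥ x≮p) (≢-sym x≢p)))
shift-unshift p zero    x≢p | false | ofⁿ x≮p = ⊥-elim (x≢p (sym (n≤0⇒n≡0 (≮⇒≥ x≮p))))

∸≡suc∸suc : ∀ {a p} → a < p → p ∸ a ≡ suc (p ∸ suc a)
∸≡suc∸suc a<p = +-∸-assoc 1 a<p

interval-insertAt : ∀ a m {p} → a ≤ p → p ≤ a + m →
  interval a (suc m) ≡ insertAt (p ∸ a) p (map (shift p) (interval a m))
interval-insertAt a zero {p} a≤p p≤a+0 with refl ← ≤-antisym a≤p (subst (p ≤_) (+-identityʳ a) p≤a+0)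
  rewrite n∸n≡0 a = refl
interval-insertAt a (suc m) {p} a≤p p≤a+m with m≤n⇒m<n∨m≡n a≤p
... | inj₂ refl rewrite n∸n≡0 a = cong (a ∷_) (sym (begin
      map (shift a) (interval a (suc m))
        ≡⟨ map-cong-local (All.tabulate (shift-≥ ∘ proj₁ ∘ ∈-interval⁻ a (suc m))) ⟩
      map suc (interval a (suc m))       ≡⟨ map-+-interval 1 a (suc m) ⟩
      interval (suc a) (suc m)           ∎))
  where open ≡-Reasoning
... | inj₁ a<p rewrite shift-< a<p | ∸≡suc∸suc a<p =
  cong (a ∷_) (interval-insertAt (suc a) m a<p (subst (p ≤_) (+-suc a m) p≤a+m))

extend : List ℕ → ℕ → List ℕ
extend π p = map (shift p) π ∷ʳ p

perms : ℕ → List (List ℕ)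
perms zero    = [] ∷ []
perms (suc m) = cartesianProductWith extend (perms m) (interval 1 (suc m))

interval-insertAt-1 : ∀ m {p} → p ∈ interval 1 (suc m) →
  interval 1 (suc m) ≡ insertAt (pred p) p (map (shift p) (interval 1 m))
interval-insertAt-1 m p∈ with 1≤p , p≤1+m ← ∈-interval⁻ 1 (suc m) p∈ =
  interval-insertAt 1 m 1≤p (≤-pred p≤1+m)

interval-∷-shifted : ∀ m {p} → p ∈ interval 1 (suc m) →
  p ∷ map (shift p) (interval 1 m) ↭ interval 1 (suc m)
interval-∷-shifted m {p} p∈ =
  ↭-trans (↭-sym (insertAt-↭ (pred p) p _)) (↭-reflexive (sym (interval-insertAt-1 m p∈)))

extend-IsPerm : ∀ {π p} → IsPerm m π → p ∈ interval 1 (suc m) → IsPerm (suc m) (extend π p)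
extend-IsPerm {m} {π} {p} π↭ p∈ = begin
  map (shift p) π ∷ʳ p              ↭⟨ ∷↭∷ʳ p _ ⟨
  p ∷ map (shift p) π               ↭⟨ ↭-prep p (map⁺-↭ (shift p) π↭) ⟩
  p ∷ map (shift p) (interval 1 m)  ↭⟨ interval-∷-shifted m p∈ ⟩
  interval 1 (suc m)                ∎
  where open PermutationReasoning

extend-injective : ∀ {π π′ p p′} → extend π p ≡ extend π′ p′ → π ≡ π′ × p ≡ p′
extend-injective {π} {π′} {p} eq with π≡ , refl ← ∷ʳ-injective (map (shift p) π) _ eq =
  map-injective (shift-injective p) π≡ , refl

perms⇒IsPerm : ∀ m {σ} → σ ∈ perms m → IsPerm m σ
perms⇒IsPerm zero    (here refl) = ↭-refl
perms⇒IsPerm (suc m) σ∈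
  with π , p , π∈ , p∈ , refl ← ∈-cartesianProductWith⁻ extend (perms m) _ σ∈ =
  extend-IsPerm (perms⇒IsPerm m π∈) p∈

perms-unique : ∀ m → Unique (perms m)
perms-unique zero    = [] ∷ []
perms-unique (suc m) =
  Unique.cartesianProductWith⁺ extend extend-injective (perms-unique m) (interval-unique 1 (suc m))

IsPerm⇒perms : ∀ m {σ} → IsPerm m σ → σ ∈ perms m
IsPerm⇒perms zero    σ↭ rewrite ↭-empty-inv σ↭ = here refl
IsPerm⇒perms (suc m) {σ} σ↭ = go (reverseView σ) σ↭
  where
  go : ∀ {σ} → Reverse σ → IsPerm (suc m) σ → σ ∈ perms (suc m)
  go []              σ↭ = contradiction (↭-length σ↭) λ ()
  go (σ₁ ∶ _ ∶ʳ p) σ↭ =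
    subst (_∈ perms (suc m)) extend-π₁≡σ
      (∈-cartesianProductWith⁺ extend (IsPerm⇒perms m π₁↭) p∈)
    where
    p∈ : p ∈ interval 1 (suc m)
    p∈ = ∈-resp-↭ σ↭ (∈-++⁺ʳ σ₁ (here refl))
    σ₁↭ : σ₁ ↭ map (shift p) (interval 1 m)
    σ₁↭ = drop-∷ (↭-trans (∷↭∷ʳ p σ₁) (↭-trans σ↭ (↭-sym (interval-∷-shifted m p∈))))
    π₁ : List ℕ
    π₁ = map (unshift p) σ₁
    π₁↭ : IsPerm m π₁
    π₁↭ = ↭-trans (map⁺-↭ (unshift p) σ₁↭)
      (↭-reflexive (trans (sym (map-∘ _)) (map-id-local (All.tabulate λ {x} _ → unshift-shift p x))))
    extend-π₁≡σ : extend π₁ p ≡ σ₁ ∷ʳ p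
    extend-π₁≡σ = cong (_∷ʳ p)
      (trans (sym (map-∘ σ₁)) (map-id-local (All.tabulate λ {x} x∈ → shift-unshift p x (x≢p x∈))))
      where
      x≢p : ∀ {x} → x ∈ σ₁ → x ≢ p
      x≢p x∈ with y , _ , refl ← ∈-map⁻ (shift p) (∈-resp-↭ σ₁↭ x∈) = shift-≢ p y

countBelow : ℕ → List ℕ → ℕ
countBelow x w = length (filterᵇ (_<ᵇ x) w)

countAbove : ℕ → List ℕ → ℕ
countAbove x w = length (filterᵇ (x <ᵇ_) w)

countBelow-↭ : ∀ x {w w′} → w ↭ w′ → countBelow x w ≡ countBelow x w′
countBelow-↭ x w↭w′ = ↭-length (filter-↭ _ w↭w′)

countAbove-↭ : ∀ x {w w′} → w ↭ w′ → countAbove x w ≡ countAbove x w′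
countAbove-↭ x w↭w′ = ↭-length (filter-↭ _ w↭w′)

countBelow-++ : ∀ x w w′ → countBelow x (w ++ w′) ≡ countBelow x w + countBelow x w′
countBelow-++ x w w′ = trans (cong length (filter-++ _ w w′)) (length-++ (filterᵇ (_<ᵇ x) w))

countBelow-map-suc : ∀ x w → countBelow (suc x) (map suc w) ≡ countBelow x w
countBelow-map-suc x []      = refl
countBelow-map-suc x (y ∷ w) with y <ᵇ x
... | true  = cong suc (countBelow-map-suc x w)
... | false = countBelow-map-suc x w

countAbove-map-suc : ∀ x w → countAbove (suc x) (map suc w) ≡ countAbove x w
countAbove-map-suc x []      = refl
countAbove-map-suc x (y ∷ w) with x <ᵇ y
... | true  = cong suc (countAbove-map-suc x w)
... | false = countAbove-map-suc x w

countBelow-interval : ∀ q n → q ≤ n → countBelow (suc q) (interval 1 n) ≡ q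
countBelow-interval zero    n       _ = countBelow-1 0 n
  where
  countBelow-1 : ∀ a n → countBelow 1 (interval (suc a) n) ≡ 0
  countBelow-1 a zero    = refl
  countBelow-1 a (suc n) = countBelow-1 (suc a) n
countBelow-interval (suc q) (suc n) (s≤s q≤n) = cong suc (begin
  countBelow (suc (suc q)) (interval 2 n)          ≡⟨ cong (countBelow (suc (suc q))) (interval-2≡map-suc n) ⟩
  countBelow (suc (suc q)) (map suc (interval 1 n)) ≡⟨ countBelow-map-suc (suc q) (interval 1 n) ⟩
  countBelow (suc q) (interval 1 n)                ≡⟨ countBelow-interval q n q≤n ⟩
  q                                                ∎)
  where open ≡-Reasoning

countAbove-interval : ∀ x n → countAbove x (interval 1 n) ≡ n ∸ x
countAbove-interval zero    n       = countAbove-0 0 n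
  where
  countAbove-0 : ∀ a n → countAbove 0 (interval (suc a) n) ≡ n
  countAbove-0 a zero    = refl
  countAbove-0 a (suc n) = cong suc (countAbove-0 (suc a) n)
countAbove-interval (suc x) zero    = refl
countAbove-interval (suc x) (suc n) = begin
  countAbove (suc x) (interval 2 n)           ≡⟨ cong (countAbove (suc x)) (interval-2≡map-suc n) ⟩
  countAbove (suc x) (map suc (interval 1 n)) ≡⟨ countAbove-map-suc x (interval 1 n) ⟩
  countAbove x (interval 1 n)                 ≡⟨ countAbove-interval x n ⟩
  n ∸ x                                       ∎
  where open ≡-Reasoning

StrictlyMonotoneOn : List ℕ → (ℕ → ℕ) → Set
StrictlyMonotoneOn xs f = ∀ {x y} → x ∈ xs → y ∈ xs → x < y → f x < f y

monotone-<ᵇ : ∀ {xs f x y} → StrictlyMonotoneOn xs f → x ∈ xs → y ∈ xs → (f x <ᵇ f y) ≡ (x <ᵇ y)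
monotone-<ᵇ {f = f} {x} {y} mono x∈ y∈ with <-cmp x y
... | tri< x<y _ _ = trans (<⇒<ᵇ≡true (mono x∈ y∈ x<y)) (sym (<⇒<ᵇ≡true x<y))
... | tri≈ _ refl _ = trans (≥⇒<ᵇ≡false {n = f x} ≤-refl) (sym (≥⇒<ᵇ≡false {n = x} ≤-refl))
... | tri> _ _ y<x = trans (≥⇒<ᵇ≡false (<⇒≤ (mono y∈ x∈ y<x))) (sym (≥⇒<ᵇ≡false (<⇒≤ y<x)))

monotoneOn-tail : ∀ {f x w} → StrictlyMonotoneOn (x ∷ w) f → StrictlyMonotoneOn w f
monotoneOn-tail mono a∈ b∈ = mono (there a∈) (there b∈)

monotoneOn-skip : ∀ {f x y w} → StrictlyMonotoneOn (x ∷ y ∷ w) f → StrictlyMonotoneOn (x ∷ w) f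
monotoneOn-skip mono a∈ b∈ = mono (skip a∈) (skip b∈)
  where
  skip : ∀ {a x y w} → a ∈ x ∷ w → a ∈ x ∷ y ∷ w
  skip (here a≡x) = here a≡x
  skip (there a∈) = there (there a∈)

shift-monotoneOn : ∀ p {xs} → StrictlyMonotoneOn xs (shift p)
shift-monotoneOn p _ _ = shift-monotone p

countBelow-map : ∀ {f x} w → StrictlyMonotoneOn (x ∷ w) f → countBelow (f x) (map f w) ≡ countBelow x w
countBelow-map []      mono = refl
countBelow-map {f} {x} (y ∷ w) mono rewrite monotone-<ᵇ mono (there (here refl)) (here refl) with y <ᵇ x
... | true  = cong suc (countBelow-map w (monotoneOn-skip mono))
... | false = countBelow-map w (monotoneOn-skip mono)

inv-map : ∀ {f} xs → StrictlyMonotoneOn xs f → inv (map f xs) ≡ inv xs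
inv-map []       mono = refl
inv-map (x ∷ xs) mono = cong₂ _+_ (countBelow-map xs mono) (inv-map xs (monotoneOn-tail mono))

inv-∷ʳ : ∀ xs p → inv (xs ∷ʳ p) ≡ inv xs + countAbove p xs
inv-∷ʳ []       p = refl
inv-∷ʳ (x ∷ xs) p rewrite countBelow-++ x xs (p ∷ []) | inv-∷ʳ xs p with p <ᵇ x
... | true  = rearrange (countBelow x xs) (inv xs) (countAbove p xs)
  where
  rearrange : ∀ a b c → (a + 1) + (b + c) ≡ (a + b) + suc c
  rearrange = solve-∀
... | false = rearrange (countBelow x xs) (inv xs) (countAbove p xs)
  where
  rearrange : ∀ a b c → (a + 0) + (b + c) ≡ (a + b) + c
  rearrange = solve-∀

inv-extend : ∀ {π p} → IsPerm m π → p ∈ interval 1 (suc m) → inv (extend π p) ≡ inv π + (suc m ∸ p)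
inv-extend {m} {π} {p} π↭ p∈ = begin
  inv (map (shift p) π ∷ʳ p)                             ≡⟨ inv-∷ʳ (map (shift p) π) p ⟩
  inv (map (shift p) π) + countAbove p (map (shift p) π) ≡⟨ cong₂ _+_ (inv-map π (shift-monotoneOn p)) above ⟩
  inv π + (suc m ∸ p)                                    ∎
  where
  open ≡-Reasoning
  shifted = map (shift p) (interval 1 m)
  above : countAbove p (map (shift p) π) ≡ suc m ∸ p
  above = begin
    countAbove p (map (shift p) π)                ≡⟨ countAbove-↭ p (map⁺-↭ (shift p) π↭) ⟩
    countAbove p shifted
      ≡⟨ cong length (filter-reject (T? ∘ (p <ᵇ_)) {x = p} {xs = shifted} p≮p) ⟨
    countAbove p (p ∷ shifted)                    ≡⟨ countAbove-↭ p (interval-∷-shifted m p∈) ⟩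
    countAbove p (interval 1 (suc m))             ≡⟨ countAbove-interval p (suc m) ⟩
    suc m ∸ p                                     ∎
    where
    p≮p : ¬ T (p <ᵇ p)
    p≮p = <-irrefl refl ∘ <ᵇ⇒< p p

inv-row : ∀ {π} → IsPerm m π →
  map (inv ∘ extend π) (interval 1 (suc m)) ↭ interval (inv π) (suc m)
inv-row {m} {π} π↭ = begin
  map (inv ∘ extend π) (interval 1 (suc m))                  ≡⟨ map-cong-local (All.tabulate (inv-extend π↭)) ⟩
  map (λ p → inv π + (suc m ∸ p)) (interval 1 (suc m))       ↭⟨ map-reflect-interval (inv π) (suc m) ⟩
  interval (inv π) (suc m)                                   ∎
  where open PermutationReasoning

-- Inverse major index

Below : ℕ → List ℕ → Set
Below M xs = ∀ {y} → y ∈ xs → y < M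

pos-++-∈ : ∀ {j} xs ys → j ∈ xs → pos j (xs ++ ys) ≡ pos j xs
pos-++-∈ {j} (x ∷ xs) ys j∈ with j ≡ᵇ x in j≡ᵇx
... | true = refl
pos-++-∈ {j} (x ∷ xs) ys (here refl) | false = ⊥-elim (subst T j≡ᵇx (≡true⇒T (≡ᵇ-refl j)))
pos-++-∈ {j} (x ∷ xs) ys (there j∈) | false = cong suc (pos-++-∈ xs ys j∈)

pos-++-∉ : ∀ {j} xs ys → j ∉ xs → pos j (xs ++ ys) ≡ length xs + pos j ys
pos-++-∉ []       ys j∉ = refl
pos-++-∉ {j} (x ∷ xs) ys j∉ with j ≡ᵇ x in j≡ᵇx
... | true  = ⊥-elim (j∉ (here (≡ᵇ⇒≡ j x (≡true⇒T j≡ᵇx))))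
... | false = cong suc (pos-++-∉ xs ys (j∉ ∘ there))

pos-head : ∀ j ys → pos j (j ∷ ys) ≡ 1
pos-head j ys rewrite ≡ᵇ-refl j = refl

pos-map : ∀ {f : ℕ → ℕ} → (∀ {a b} → f a ≡ f b → a ≡ b) →
  ∀ j xs → pos (f j) (map f xs) ≡ pos j xs
pos-map f-inj j []       = refl
pos-map f-inj j (x ∷ xs) rewrite injective-≡ᵇ f-inj j x =
  cong (λ r → if j ≡ᵇ x then 1 else suc r) (pos-map f-inj j xs)

pos-≤ : ∀ j w → pos j w ≤ length w
pos-≤ j []      = z≤n
pos-≤ j (y ∷ w) with j ≡ᵇ y
... | true  = s≤s z≤n
... | false = s≤s (pos-≤ j w)

inverse-IsPerm : ∀ {π} → IsPerm m π → inverse π ≡ map (λ j → pos j π) (interval 1 m)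
inverse-IsPerm {π = π} π↭ =
  cong (map (λ j → pos j π)) (trans (cong range1 (IsPerm-length π↭)) (range1≡interval _))

length-inverse : ∀ w → length (inverse w) ≡ length w
length-inverse w = trans (length-map _ (range1 (length w))) (length-applyUpTo suc (length w))

inverse-below : ∀ w → Below (suc (length (inverse w))) (inverse w)
inverse-below w y∈ with j , _ , refl ← ∈-map⁻ (λ j → pos j w) y∈ =
  s≤s (subst (pos j w ≤_) (sym (length-inverse w)) (pos-≤ j w))

inverse-extend : ∀ {π p} → IsPerm m π → p ∈ interval 1 (suc m) →
  inverse (extend π p) ≡ insertAt (pred p) (suc m) (inverse π)
inverse-extend {m} {π} {p} π↭ p∈ = begin
  inverse σ                                                  ≡⟨ inverse-IsPerm (extend-IsPerm π↭ p∈) ⟩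
  map posσ (interval 1 (suc m))                              ≡⟨ cong (map posσ) (interval-insertAt-1 m p∈) ⟩
  map posσ (insertAt (pred p) p (map (shift p) (interval 1 m)))
    ≡⟨ map-insertAt posσ (pred p) p _ ⟩
  insertAt (pred p) (posσ p) (map posσ (map (shift p) (interval 1 m)))
    ≡⟨ cong₂ (insertAt (pred p)) posσ-p (sym (map-∘ _)) ⟩
  insertAt (pred p) (suc m) (map (posσ ∘ shift p) (interval 1 m))
    ≡⟨ cong (insertAt (pred p) (suc m)) (map-cong-local (All.tabulate posσ-shift)) ⟩
  insertAt (pred p) (suc m) (map (λ j → pos j π) (interval 1 m))
    ≡⟨ cong (insertAt (pred p) (suc m)) (inverse-IsPerm π↭) ⟨
  insertAt (pred p) (suc m) (inverse π)                      ∎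
  where
  open ≡-Reasoning
  σ = extend π p
  posσ = λ j → pos j σ
  posσ-p : pos p σ ≡ suc m
  posσ-p = begin
    pos p (map (shift p) π ++ p ∷ [])         ≡⟨ pos-++-∉ (map (shift p) π) (p ∷ []) p∉ ⟩
    length (map (shift p) π) + pos p (p ∷ [])
      ≡⟨ cong₂ _+_ (trans (length-map (shift p) π) (IsPerm-length π↭)) (pos-head p []) ⟩
    m + 1                                     ≡⟨ +-comm m 1 ⟩
    suc m                                     ∎
    where
    p∉ : p ∉ map (shift p) π
    p∉ p∈ with x , _ , p≡ ← ∈-map⁻ (shift p) p∈ = shift-≢ p x (sym p≡)
  posσ-shift : ∀ {j} → j ∈ interval 1 m → pos (shift p j) σ ≡ pos j π
  posσ-shift j∈ = trans (pos-++-∈ (map (shift p) π) (p ∷ []) (∈-map⁺ (shift p) (∈-resp-↭ (↭-sym π↭) j∈)))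
                        (pos-map (shift-injective p) _ π)

maj : List ℕ → ℕ
maj w = sum (DES w)

leadingDescent : ℕ → ℕ → List ℕ → List ℕ
leadingDescent i x []      = []
leadingDescent i x (y ∷ _) = if y <ᵇ x then i ∷ [] else []

desFrom-∷ : ∀ i x ys → desFrom i (x ∷ ys) ≡ leadingDescent i x ys ++ desFrom (suc i) ys
desFrom-∷ i x []      = refl
desFrom-∷ i x (y ∷ ys) with y <ᵇ x
... | true  = refl
... | false = refl

leadingDescent-∷ʳ : ∀ i x xs b a →
  leadingDescent i x ((xs ∷ʳ b) ∷ʳ a) ≡ leadingDescent i x (xs ∷ʳ b)
leadingDescent-∷ʳ i x []      b a = refl
leadingDescent-∷ʳ i x (_ ∷ _) b a = refl

descentAt : ℕ → ℕ → ℕ → List ℕ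
descentAt i b a = if a <ᵇ b then i ∷ [] else []

desFrom-∷ʳ : ∀ i xs b a →
  desFrom i ((xs ∷ʳ b) ∷ʳ a) ≡ desFrom i (xs ∷ʳ b) ++ descentAt (i + length xs) b a
desFrom-∷ʳ i []       b a = cong (λ k → descentAt k b a) (sym (+-identityʳ i))
desFrom-∷ʳ i (x ∷ xs) b a = begin
  desFrom i (x ∷ ((xs ∷ʳ b) ∷ʳ a))
    ≡⟨ desFrom-∷ i x ((xs ∷ʳ b) ∷ʳ a) ⟩
  leadingDescent i x ((xs ∷ʳ b) ∷ʳ a) ++ desFrom (suc i) ((xs ∷ʳ b) ∷ʳ a)
    ≡⟨ cong₂ _++_ (leadingDescent-∷ʳ i x xs b a) (desFrom-∷ʳ (suc i) xs b a) ⟩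
  leadingDescent i x (xs ∷ʳ b) ++ (desFrom (suc i) (xs ∷ʳ b) ++ descentAt (suc i + length xs) b a)
    ≡⟨ sym (++-assoc (leadingDescent i x (xs ∷ʳ b)) _ _) ⟩
  (leadingDescent i x (xs ∷ʳ b) ++ desFrom (suc i) (xs ∷ʳ b)) ++ descentAt (suc i + length xs) b a
    ≡⟨ cong₂ _++_ (sym (desFrom-∷ i x (xs ∷ʳ b))) (cong (λ k → descentAt k b a) (sym (+-suc i (length xs)))) ⟩
  desFrom i (x ∷ (xs ∷ʳ b)) ++ descentAt (i + suc (length xs)) b a
    ∎
  where open ≡-Reasoning

maj-∷ʳ : ∀ xs b a →
  maj ((xs ∷ʳ b) ∷ʳ a) ≡ maj (xs ∷ʳ b) + (if a <ᵇ b then suc (length xs) else 0)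
maj-∷ʳ xs b a = trans (cong sum (desFrom-∷ʳ 1 xs b a))
  (trans (sum-++ (DES (xs ∷ʳ b)) _) (cong (maj (xs ∷ʳ b) +_) (sum-descentAt (a <ᵇ b))))
  where
  sum-descentAt : ∀ t →
    sum (if t then suc (length xs) ∷ [] else []) ≡ (if t then suc (length xs) else 0)
  sum-descentAt true  = +-identityʳ _
  sum-descentAt false = refl

maj-∷ʳ-max : ∀ {M} xs → Below M xs → maj (xs ∷ʳ M) ≡ maj xs
maj-∷ʳ-max xs = go (reverseView xs)
  where
  go : ∀ {M xs} → Reverse xs → Below M xs → maj (xs ∷ʳ M) ≡ maj xs
  go []               _    = refl
  go {M} (ys ∶ _ ∶ʳ b) <M rewrite maj-∷ʳ ys b M | ≥⇒<ᵇ≡false (<⇒≤ (<M (∈-++⁺ʳ ys (here refl)))) =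
    +-identityʳ _

majInserting : ℕ → List ℕ → ℕ → ℕ
majInserting M xs k = maj (insertAt k M xs)

majInserting-∷ʳ : ∀ M ys b a {k} → k ≤ length ys →
  majInserting M ((ys ∷ʳ b) ∷ʳ a) k ≡
    (if a <ᵇ b then suc (length (ys ∷ʳ b)) else 0) + majInserting M (ys ∷ʳ b) k
majInserting-∷ʳ M ys b a {k} k≤|ys| = begin
  maj (insertAt k M ((ys ∷ʳ b) ∷ʳ a))   ≡⟨ cong maj (insertAt-∷ʳ k M (ys ∷ʳ b) a k≤|ys∷ʳb|) ⟩
  maj (insertAt k M (ys ∷ʳ b) ∷ʳ a)     ≡⟨ cong (λ w → maj (w ∷ʳ a)) (insertAt-∷ʳ k M ys b k≤|ys|) ⟩
  maj ((insertAt k M ys ∷ʳ b) ∷ʳ a)     ≡⟨ maj-∷ʳ (insertAt k M ys) b a ⟩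
  maj (insertAt k M ys ∷ʳ b) + (if a <ᵇ b then suc (length (insertAt k M ys)) else 0)
    ≡⟨ cong₂ _+_ (cong maj (sym (insertAt-∷ʳ k M ys b k≤|ys|)))
                 (cong (λ n → if a <ᵇ b then suc n else 0) |insertAt|≡) ⟩
  majInserting M (ys ∷ʳ b) k + (if a <ᵇ b then suc (length (ys ∷ʳ b)) else 0)
    ≡⟨ +-comm (majInserting M (ys ∷ʳ b) k) _ ⟩
  (if a <ᵇ b then suc (length (ys ∷ʳ b)) else 0) + majInserting M (ys ∷ʳ b) k ∎
  where
  open ≡-Reasoning
  k≤|ys∷ʳb| = subst (k ≤_) (sym (length-∷ʳ ys b)) (m≤n⇒m≤1+n k≤|ys|)
  |insertAt|≡ = trans (length-insertAt k M ys) (sym (length-∷ʳ ys b))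

majInserting-∷ʳ-end : ∀ M xs a → Below M (xs ∷ʳ a) →
  majInserting M (xs ∷ʳ a) (length xs) ≡ maj xs + suc (length xs)
majInserting-∷ʳ-end M xs a <M = begin
  maj (insertAt (length xs) M (xs ∷ʳ a))
    ≡⟨ cong maj (trans (insertAt-∷ʳ (length xs) M xs a ≤-refl) (cong (_∷ʳ a) (insertAt-length M xs))) ⟩
  maj ((xs ∷ʳ M) ∷ʳ a)               ≡⟨ maj-∷ʳ xs M a ⟩
  maj (xs ∷ʳ M) + (if a <ᵇ M then suc (length xs) else 0)
    ≡⟨ cong₂ _+_ (maj-∷ʳ-max xs (<M ∘ ∈-++⁺ˡ))
                 (cong (λ t → if t then suc (length xs) else 0) (<⇒<ᵇ≡true (<M (∈-++⁺ʳ xs (here refl))))) ⟩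
  maj xs + suc (length xs)           ∎
  where open ≡-Reasoning

interval-∷ʳ-regroup : ∀ t v L →
  interval ((if t then suc L else 0) + suc v) L ∷ʳ (v + suc L) ↭
  interval (suc (v + (if t then L else 0))) (suc L)
interval-∷ʳ-regroup true  v L = begin
  interval (suc L + suc v) L ∷ʳ (v + suc L)      ↭⟨ ∷↭∷ʳ _ _ ⟨
  v + suc L ∷ interval (suc L + suc v) L         ≡⟨ cong₂ (λ a b → a ∷ interval b L) (+-suc v L) L+v≡v+L ⟩
  interval (suc (v + L)) (suc L)                 ∎
  where
  open PermutationReasoning
  L+v≡v+L : suc L + suc v ≡ suc (suc (v + L))
  L+v≡v+L = cong suc (trans (+-suc L v) (cong suc (+-comm L v)))
interval-∷ʳ-regroup false v L = ↭-reflexive (begin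
  interval (suc v) L ∷ʳ (v + suc L)              ≡⟨ cong (interval (suc v) L ∷ʳ_) (+-suc v L) ⟩
  interval (suc v) L ∷ʳ (suc v + L)              ≡⟨ interval-∷ʳ (suc v) L ⟨
  interval (suc v) (suc L)                       ≡⟨ cong (λ u → interval (suc u) (suc L)) (+-identityʳ v) ⟨
  interval (suc (v + 0)) (suc L)                 ∎)
  where open ≡-Reasoning

InnerInsertionMajors : ℕ → List ℕ → Set
InnerInsertionMajors M xs =
  map (majInserting M xs) (interval 0 (length xs)) ↭ interval (suc (maj xs)) (length xs)

-- Inserting M before the last letter a leaves the pair b a adjacent, one place further right.
innerInsertionMajors-∷ʳ : ∀ {M} ys b a → Below M ((ys ∷ʳ b) ∷ʳ a) →
  InnerInsertionMajors M (ys ∷ʳ b) → InnerInsertionMajors M ((ys ∷ʳ b) ∷ʳ a)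
innerInsertionMajors-∷ʳ {M} ys b a <M ih = begin
  map (majInserting M x) (interval 0 (length x))
    ≡⟨ cong (λ n → map (majInserting M x) (interval 0 n)) (length-∷ʳ xs a) ⟩
  map (majInserting M x) (interval 0 (suc L))
    ≡⟨ trans (cong (map (majInserting M x)) (interval-∷ʳ 0 L)) (map-++ _ (interval 0 L) (L ∷ [])) ⟩
  map (majInserting M x) (interval 0 L) ∷ʳ majInserting M x L
    ≡⟨ cong₂ _∷ʳ_ (trans (map-cong-local (All.tabulate inner)) (map-∘ (interval 0 L)))
                  (majInserting-∷ʳ-end M xs a <M) ⟩
  map (c +_) (map (majInserting M xs) (interval 0 L)) ∷ʳ (maj xs + suc L)
    ↭⟨ ++⁺ʳ _ (map⁺-↭ (c +_) ih) ⟩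
  map (c +_) (interval (suc (maj xs)) L) ∷ʳ (maj xs + suc L)
    ≡⟨ cong (_∷ʳ (maj xs + suc L)) (map-+-interval c (suc (maj xs)) L) ⟩
  interval (c + suc (maj xs)) L ∷ʳ (maj xs + suc L)
    ↭⟨ interval-∷ʳ-regroup (a <ᵇ b) (maj xs) L ⟩
  interval (suc (maj xs + (if a <ᵇ b then L else 0))) (suc L)
    ≡⟨ cong₂ (λ v n → interval (suc v) n) maj-x (sym (length-∷ʳ xs a)) ⟩
  interval (suc (maj x)) (length x) ∎
  where
  open PermutationReasoning
  xs = ys ∷ʳ b
  x  = xs ∷ʳ a
  L  = length xs
  c  = if a <ᵇ b then suc L else 0
  inner : ∀ {k} → k ∈ interval 0 L → majInserting M x k ≡ c + majInserting M xs k
  inner k∈ = majInserting-∷ʳ M ys b a (≤-pred (subst (_ <_) (length-∷ʳ ys b) (proj₂ (∈-interval⁻ 0 L k∈))))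
  maj-x : maj xs + (if a <ᵇ b then L else 0) ≡ maj x
  maj-x = sym (trans (maj-∷ʳ ys b a)
                     (cong (λ n → maj xs + (if a <ᵇ b then n else 0)) (sym (length-∷ʳ ys b))))

innerInsertionMajors : ∀ {M} xs → Below M xs → InnerInsertionMajors M xs
innerInsertionMajors xs = go (reverseView xs)
  where
  go : ∀ {M xs} → Reverse xs → Below M xs → InnerInsertionMajors M xs
  go []                               _  = ↭-refl
  go (_ ∶ [] ∶ʳ a)                    <M rewrite <⇒<ᵇ≡true (<M (here refl)) = ↭-refl
  go (_ ∶ ys∷ʳb@(ys ∶ _ ∶ʳ b) ∶ʳ a) <M =
    innerInsertionMajors-∷ʳ ys b a <M (go ys∷ʳb (<M ∘ ∈-++⁺ˡ))

insertionMajors : ∀ {M} xs → Below M xs →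
  map (majInserting M xs) (interval 0 (suc (length xs))) ↭ interval (maj xs) (suc (length xs))
insertionMajors {M} xs <M = begin
  map (majInserting M xs) (interval 0 (suc L))       ≡⟨ cong (map _) (interval-∷ʳ 0 L) ⟩
  map (majInserting M xs) (interval 0 L ++ L ∷ [])   ≡⟨ map-++ _ (interval 0 L) (L ∷ []) ⟩
  inner ∷ʳ majInserting M xs L                       ≡⟨ cong (λ w → inner ∷ʳ maj w) (insertAt-length M xs) ⟩
  inner ∷ʳ maj (xs ∷ʳ M)                             ≡⟨ cong (inner ∷ʳ_) (maj-∷ʳ-max xs <M) ⟩
  inner ∷ʳ maj xs                                    ↭⟨ ++⁺ʳ _ (innerInsertionMajors xs <M) ⟩
  interval (suc (maj xs)) L ∷ʳ maj xs                ↭⟨ ∷↭∷ʳ (maj xs) _ ⟨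
  interval (maj xs) (suc L)                          ∎
  where
  open PermutationReasoning
  L = length xs
  inner = map (majInserting M xs) (interval 0 L)

imaj-row : ∀ {π} → IsPerm m π →
  map (imaj ∘ extend π) (interval 1 (suc m)) ↭ interval (imaj π) (suc m)
imaj-row {m} {π} π↭ = begin
  map (imaj ∘ extend π) (interval 1 (suc m))
    ≡⟨ map-cong-local (All.tabulate (cong maj ∘ inverse-extend π↭)) ⟩
  map (majInserting (suc m) τ ∘ pred) (interval 1 (suc m))
    ≡⟨ trans (map-∘ (interval 1 (suc m))) (cong (map _) (map-pred-interval 0 (suc m))) ⟩
  map (majInserting (suc m) τ) (interval 0 (suc m))
    ≡⟨ cong (λ n → map (majInserting (suc n) τ) (interval 0 (suc n))) |τ|≡m ⟨
  map (majInserting (suc (length τ)) τ) (interval 0 (suc (length τ)))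
    ↭⟨ insertionMajors τ (inverse-below π) ⟩
  interval (maj τ) (suc (length τ))
    ≡⟨ cong (λ n → interval (maj τ) (suc n)) |τ|≡m ⟩
  interval (imaj π) (suc m) ∎
  where
  open PermutationReasoning
  τ = inverse π
  |τ|≡m : length τ ≡ m
  |τ|≡m = trans (length-inverse π) (IsPerm-length π↭)

firstAscent-map : ∀ {f} xs → StrictlyMonotoneOn xs f → firstAscent (map f xs) ≡ firstAscent xs
firstAscent-map []           mono = refl
firstAscent-map (x ∷ [])     mono = refl
firstAscent-map (x ∷ y ∷ ys) mono =
  cong₂ (λ b n → if b then 1 else suc n) (monotone-<ᵇ mono (here refl) (there (here refl)))
    (firstAscent-map (y ∷ ys) (monotoneOn-tail mono))

firstAscent-≥1 : ∀ x xs → 1 ≤ firstAscent (x ∷ xs)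
firstAscent-≥1 x []      = s≤s z≤n
firstAscent-≥1 x (y ∷ _) with x <ᵇ y
... | true  = s≤s z≤n
... | false = s≤s z≤n

firstAscent-≤-length : ∀ xs → firstAscent xs ≤ length xs
firstAscent-≤-length []           = z≤n
firstAscent-≤-length (x ∷ [])     = s≤s z≤n
firstAscent-≤-length (x ∷ y ∷ ys) = step (x <ᵇ y) (firstAscent-≤-length (y ∷ ys))
  where
  step : ∀ b {a n} → a ≤ n → (if b then 1 else suc a) ≤ suc n
  step true  _   = s≤s z≤n
  step false a≤n = s≤s a≤n

firstAscent-++ : ∀ j xs ys → j ≤ length xs → (j ≤ᵇ firstAscent (xs ++ ys)) ≡ (j ≤ᵇ firstAscent xs)
firstAscent-++ zero          xs           ys _         = refl
firstAscent-++ (suc zero)    (x ∷ [])     ys _         = ≤⇒≤ᵇ≡true (firstAscent-≥1 x ys)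
firstAscent-++ (suc j)       (x ∷ y ∷ zs) ys (s≤s j≤) with x <ᵇ y
... | true  = refl
... | false = trans (suc≤ᵇsuc j _) (trans (firstAscent-++ j (y ∷ zs) ys j≤) (sym (suc≤ᵇsuc j _)))
  where
  suc≤ᵇsuc : ∀ j a → (suc j ≤ᵇ suc a) ≡ (j ≤ᵇ a)
  suc≤ᵇsuc zero    a = refl
  suc≤ᵇsuc (suc j) a = refl

firstAscent-ascent : ∀ as {a b} ys → a < b → firstAscent (as ++ a ∷ b ∷ ys) ≤ suc (length as)
firstAscent-ascent []       ys a<b rewrite <⇒<ᵇ≡true a<b = s≤s z≤n
firstAscent-ascent (x ∷ as) ys a<b =
  ≤-trans (firstAscent-∷ x (as ++ _ ∷ _ ∷ ys)) (s≤s (firstAscent-ascent as ys a<b))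
  where
  firstAscent-∷ : ∀ x xs → firstAscent (x ∷ xs) ≤ suc (firstAscent xs)
  firstAscent-∷ x []      = s≤s z≤n
  firstAscent-∷ x (y ∷ _) with x <ᵇ y
  ... | true  = s≤s z≤n
  ... | false = ≤-refl

firstAscent-extend : ∀ {j π} p → j ≤ m → IsPerm m π →
  (j ≤ᵇ firstAscent (extend π p)) ≡ (j ≤ᵇ firstAscent π)
firstAscent-extend {j = j} {π} p j≤m π↭ = begin
  (j ≤ᵇ firstAscent (map (shift p) π ++ p ∷ []))
    ≡⟨ firstAscent-++ j (map (shift p) π) (p ∷ []) (subst (j ≤_) (sym |shifted|≡m) j≤m) ⟩
  (j ≤ᵇ firstAscent (map (shift p) π))    ≡⟨ cong (j ≤ᵇ_) (firstAscent-map π (shift-monotoneOn p)) ⟩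
  (j ≤ᵇ firstAscent π)                    ∎
  where
  open ≡-Reasoning
  |shifted|≡m = trans (length-map (shift p) π) (IsPerm-length π↭)

firstAscent-extend-≥ : ∀ {j π} p → j ≤ m → IsPerm m π → j ≤ firstAscent (extend π p) → j ≤ firstAscent π
firstAscent-extend-≥ {j = j} p j≤m π↭ j≤fA =
  ≤ᵇ⇒≤ j _ (≡true⇒T (trans (sym (firstAscent-extend p j≤m π↭)) (≤⇒≤ᵇ≡true j≤fA)))

decreasing : ℕ → List ℕ
decreasing zero    = []
decreasing (suc m) = extend (decreasing m) 1

decreasing-∈-perms : ∀ m → decreasing m ∈ perms m
decreasing-∈-perms zero    = here refl
decreasing-∈-perms (suc m) = ∈-cartesianProductWith⁺ extend (decreasing-∈-perms m) (here refl)

decreasing-IsPerm : ∀ m → IsPerm m (decreasing m)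
decreasing-IsPerm m = perms⇒IsPerm m (decreasing-∈-perms m)

extend-decreasing-ascent : ∀ m {p} → p ∈ interval 1 (suc m) → 1 < p →
  firstAscent (extend (decreasing m) p) ≤ m
extend-decreasing-ascent zero    (here refl) (s≤s ())
extend-decreasing-ascent (suc m) {p} p∈ 1<p =
  subst (λ w → firstAscent w ≤ suc m) (sym σ≡)
    (subst (λ n → firstAscent (as ++ 1 ∷ p ∷ []) ≤ suc n) |as|≡m (firstAscent-ascent as [] 1<p))
  where
  as = map (shift p) (map (shift 1) (decreasing m))
  σ≡ : extend (decreasing (suc m)) p ≡ as ++ 1 ∷ p ∷ []
  σ≡ = trans (cong (_∷ʳ p) (map-++ (shift p) (map (shift 1) (decreasing m)) (1 ∷ [])))
             (trans (cong (λ x → (as ++ x ∷ []) ∷ʳ p) (shift-< 1<p)) (++-assoc as (1 ∷ []) (p ∷ [])))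
  |as|≡m : length as ≡ m
  |as|≡m = trans (length-map (shift p) (map (shift 1) (decreasing m)))
            (trans (length-map (shift 1) (decreasing m)) (IsPerm-length (decreasing-IsPerm m)))

decreasing-unique : ∀ m {σ} → σ ∈ perms m → m ≤ firstAscent σ → σ ≡ decreasing m
decreasing-unique zero    (here refl) _ = refl
decreasing-unique (suc m) σ∈ m<fA
  with π , p , π∈ , p∈ , refl ← ∈-cartesianProductWith⁻ extend (perms m) _ σ∈ = last p p∈ m<fA
  where
  π≡ : π ≡ decreasing m
  π≡ = decreasing-unique m π∈ (firstAscent-extend-≥ p ≤-refl (perms⇒IsPerm m π∈) (≤-trans (n≤1+n m) m<fA))
  last : ∀ p → p ∈ interval 1 (suc m) → suc m ≤ firstAscent (extend π p) →
    extend π p ≡ decreasing (suc m)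
  last zero          p∈ _    = ⊥-elim (1+n≰n (proj₁ (∈-interval⁻ 1 (suc m) p∈)))
  last (suc zero)    _  _    = cong (λ π → extend π 1) π≡
  last (suc (suc q)) p∈ m<fA = ⊥-elim (1+n≰n (≤-trans m<fA
    (subst (λ π → firstAscent (extend π (suc (suc q))) ≤ m) (sym π≡) (extend-decreasing-ascent m p∈ (s<s z<s)))))

triangle : ℕ → ℕ
triangle zero    = 0
triangle (suc m) = m + triangle m

countdown : ℕ → List ℕ
countdown zero    = []
countdown (suc m) = suc m ∷ countdown m

inverse-decreasing : ∀ m → inverse (decreasing m) ≡ countdown m
inverse-decreasing zero    = refl
inverse-decreasing (suc m) =
  trans (inverse-extend (decreasing-IsPerm m) (here refl)) (cong (suc m ∷_) (inverse-decreasing m))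

inv-decreasing : ∀ m → inv (decreasing m) ≡ triangle m
inv-decreasing zero    = refl
inv-decreasing (suc m) = trans (inv-extend (decreasing-IsPerm m) (here refl))
  (trans (cong (_+ m) (inv-decreasing m)) (+-comm (triangle m) m))

sum-desFrom-countdown : ∀ i k → sum (desFrom i (countdown (suc k))) ≡ k * i + triangle k
sum-desFrom-countdown i zero    = refl
sum-desFrom-countdown i (suc k) rewrite <⇒<ᵇ≡true (n<1+n (suc k)) | sum-desFrom-countdown (suc i) k =
  rearrange i k (triangle k)
  where
  rearrange : ∀ i k t → i + (k * suc i + t) ≡ i + k * i + (k + t)
  rearrange = solve-∀

imaj-decreasing : ∀ m → imaj (decreasing m) ≡ inv (decreasing m)
imaj-decreasing m = begin
  maj (inverse (decreasing m)) ≡⟨ cong maj (inverse-decreasing m) ⟩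
  maj (countdown m)            ≡⟨ maj-countdown m ⟩
  triangle m                   ≡⟨ inv-decreasing m ⟨
  inv (decreasing m)           ∎
  where
  open ≡-Reasoning
  maj-countdown : ∀ m → maj (countdown m) ≡ triangle m
  maj-countdown zero    = refl
  maj-countdown (suc k) = trans (sum-desFrom-countdown 1 k) (cong (_+ triangle k) (*-identityʳ k))

permsFirstAscent≥ : ℕ → ℕ → List (List ℕ)
permsFirstAscent≥ j m = filterᵇ (λ σ → j ≤ᵇ firstAscent σ) (perms m)

permsFirstAscent≥-suc : ∀ {j m} → j ≤ m →
  permsFirstAscent≥ j (suc m) ≡ cartesianProductWith extend (permsFirstAscent≥ j m) (interval 1 (suc m))
permsFirstAscent≥-suc {j} {m} j≤m = filterᵇ-cartesianProductWith extend (perms m) (interval 1 (suc m))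
  (λ {π} {p} π∈ → firstAscent-extend p j≤m (perms⇒IsPerm m π∈))

map-permsFirstAscent≥-suc : ∀ {j m} (stat : List ℕ → ℕ) → j ≤ m →
  (∀ {π} → IsPerm m π → map (stat ∘ extend π) (interval 1 (suc m)) ↭ interval (stat π) (suc m)) →
  map stat (permsFirstAscent≥ j (suc m)) ↭
  concatMap (λ v → interval v (suc m)) (map stat (permsFirstAscent≥ j m))
map-permsFirstAscent≥-suc {j} {m} stat j≤m row = begin
  map stat (permsFirstAscent≥ j (suc m))
    ≡⟨ cong (map stat) (permsFirstAscent≥-suc j≤m) ⟩
  map stat (cartesianProductWith extend (permsFirstAscent≥ j m) (interval 1 (suc m)))
    ↭⟨ map-cartesianProductWith-↭ extend stat stat (λ v → interval v (suc m)) _ _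
         (λ π∈ → row (perms⇒IsPerm m (proj₁ (∈-filter⁻ _ π∈)))) ⟩
  concatMap (λ v → interval v (suc m)) (map stat (permsFirstAscent≥ j m)) ∎
  where open PermutationReasoning

imaj-inv-equidistributed-≥ : ∀ m j → Equidistributed imaj inv (permsFirstAscent≥ j m)
imaj-inv-equidistributed-≥ m j with m ≤? j
... | yes m≤j = ↭-reflexive (map-cong-local (All.tabulate imaj≡inv))
  where
  imaj≡inv : ∀ {σ} → σ ∈ permsFirstAscent≥ j m → imaj σ ≡ inv σ
  imaj≡inv σ∈ with σ∈perms , j≤fA ← ∈-filter⁻ (T? ∘ (λ σ → j ≤ᵇ firstAscent σ)) σ∈
              with refl ← decreasing-unique m σ∈perms (≤-trans m≤j (≤ᵇ⇒≤ j _ j≤fA)) = imaj-decreasing m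
imaj-inv-equidistributed-≥ zero    j | no m≰j = ⊥-elim (m≰j z≤n)
imaj-inv-equidistributed-≥ (suc m) j | no m≰j = begin
  map imaj (permsFirstAscent≥ j (suc m))                   ↭⟨ map-permsFirstAscent≥-suc imaj j≤m imaj-row ⟩
  concatMap rowOf (map imaj (permsFirstAscent≥ j m))       ↭⟨ concatMap-↭ rowOf (imaj-inv-equidistributed-≥ m j) ⟩
  concatMap rowOf (map inv (permsFirstAscent≥ j m))        ↭⟨ map-permsFirstAscent≥-suc inv j≤m inv-row ⟨
  map inv (permsFirstAscent≥ j (suc m))                    ∎
  where
  open PermutationReasoning
  rowOf = λ v → interval v (suc m)
  j≤m : j ≤ m
  j≤m = ≤-pred (≰⇒> m≰j)

-- For m = 0 this is [[]]: the empty word, which is Desar σ for increasing σ.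
desarrangements : ℕ → List (List ℕ)
desarrangements m = filterᵇ (λ π → evenᵇ (firstAscent π)) (perms m)

imaj-inv-equidistributed : ∀ m → Equidistributed imaj inv (desarrangements m)
imaj-inv-equidistributed m =
  equidistributed-classes firstAscent (imaj-inv-equidistributed-≥ m) evenᵇ (suc m) fA<suc-m
  where
  fA<suc-m : ∀ {π} → π ∈ perms m → firstAscent π < suc m
  fA<suc-m {π} π∈ =
    s≤s (subst (firstAscent π ≤_) (IsPerm-length (perms⇒IsPerm m π∈)) (firstAscent-≤-length π))

-- The factorization σ = σᵖ σᵈ

Increasing : List ℕ → Set
Increasing = AllPairs _<_

increasing-≡ : ∀ {xs ys} → Increasing xs → Increasing ys →
  (∀ {z} → z ∈ xs → z ∈ ys) → (∀ {z} → z ∈ ys → z ∈ xs) → xs ≡ ys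
increasing-≡ []               []               _  _  = refl
increasing-≡ []               (_ ∷ _)          _  ys⊆ with () ← ys⊆ (here refl)
increasing-≡ (_ ∷ _)          []               xs⊆ _ with () ← xs⊆ (here refl)
increasing-≡ {x ∷ xs} {y ∷ ys} (x< ∷ xs↑) (y< ∷ ys↑) xs⊆ ys⊆ with x≡y
  where
  x≡y : x ≡ y
  x≡y with xs⊆ (here refl) | ys⊆ (here refl)
  ... | here x≡y  | _         = x≡y
  ... | there _   | here y≡x  = sym y≡x
  ... | there x∈  | there y∈  = ⊥-elim (<-asym (All.lookup y< x∈) (All.lookup x< y∈))
... | refl = cong (x ∷_) (increasing-≡ xs↑ ys↑ (tail x< xs⊆) (tail y< ys⊆))
  where
  tail : ∀ {as bs} → All (x <_) as → (∀ {z} → z ∈ x ∷ as → z ∈ x ∷ bs) → ∀ {z} → z ∈ as → z ∈ bs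
  tail x<as as⊆ z∈ with as⊆ (there z∈)
  ... | here refl = ⊥-elim (<-irrefl refl (All.lookup x<as z∈))
  ... | there z∈′ = z∈′

elementsFrom : ∀ {n} → ℕ → Subset n → List ℕ
elementsFrom a []          = []
elementsFrom a (true ∷ v)  = a ∷ elementsFrom (suc a) v
elementsFrom a (false ∷ v) = elementsFrom (suc a) v

elementsFrom-bounds : ∀ {n z} a (v : Subset n) → z ∈ elementsFrom a v → a ≤ z × z < a + n
elementsFrom-bounds {suc n} a (true ∷ v) (here refl) = ≤-refl , m<m+n a z<s
elementsFrom-bounds {suc n} {z} a (true ∷ v) (there z∈)
  with a<z , z< ← elementsFrom-bounds (suc a) v z∈ = <⇒≤ a<z , subst (z <_) (sym (+-suc a n)) z<
elementsFrom-bounds {suc n} {z} a (false ∷ v) z∈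
  with a<z , z< ← elementsFrom-bounds (suc a) v z∈ = <⇒≤ a<z , subst (z <_) (sym (+-suc a n)) z<

elementsFrom-increasing : ∀ {n} a (v : Subset n) → Increasing (elementsFrom a v)
elementsFrom-increasing a []          = []
elementsFrom-increasing a (true ∷ v)  =
  All.tabulate (proj₁ ∘ elementsFrom-bounds (suc a) v) ∷ elementsFrom-increasing (suc a) v
elementsFrom-increasing a (false ∷ v) = elementsFrom-increasing (suc a) v

elementsFrom-∁ : ∀ {n} a (v : Subset n) → elementsFrom a v ++ elementsFrom a (∁ v) ↭ interval a n
elementsFrom-∁ a []          = ↭-refl
elementsFrom-∁ a (true ∷ v)  = ↭-prep a (elementsFrom-∁ (suc a) v)
elementsFrom-∁ a (false ∷ v) =
  ↭-trans (↭-shift a (elementsFrom (suc a) v) _) (↭-prep a (elementsFrom-∁ (suc a) v))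

tabulate-memᵇ-elementsFrom : ∀ {n} a (v : Subset n) →
  tabulate (λ i → memᵇ (a + toℕ i) (elementsFrom a v)) ≡ v
tabulate-memᵇ-elementsFrom a []          = refl
tabulate-memᵇ-elementsFrom a (b ∷ v) =
  cong₂ _∷_ (head b) (trans (tabulate-cong (tail b)) (tabulate-memᵇ-elementsFrom (suc a) v))
  where
  below : ∀ {z} → z < suc a → memᵇ z (elementsFrom (suc a) v) ≡ false
  below z<1+a = ∉⇒memᵇ _ (λ z∈ → <⇒≱ z<1+a (proj₁ (elementsFrom-bounds (suc a) v z∈)))
  head : ∀ b → memᵇ (a + 0) (elementsFrom a (b ∷ v)) ≡ b
  head true  rewrite +-identityʳ a | ≡ᵇ-refl a = refl
  head false rewrite +-identityʳ a = below (n<1+n a)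
  tail : ∀ b i →
    memᵇ (a + toℕ (Fin.suc i)) (elementsFrom a (b ∷ v)) ≡ memᵇ (suc a + toℕ i) (elementsFrom (suc a) v)
  tail b i rewrite +-suc a (toℕ i) with b
  ... | true  rewrite ≢⇒≡ᵇ≡false {suc (a + toℕ i)} {a} (≢-sym (<⇒≢ (s≤s (m≤m+n a (toℕ i))))) = refl
  ... | false = refl

memᵇ-PIX : ∀ {n σ} (A : Subset n) → PIX n σ ≡ A →
  ∀ {z} → 1 ≤ z → z ≤ n → memᵇ z (pixPart σ) ≡ memᵇ z (elementsFrom 1 A)
memᵇ-PIX A PIX≡A {zero} () _
memᵇ-PIX {n} {σ} A PIX≡A {suc q} _ 1+q≤n = begin
  memᵇ (suc q) (pixPart σ)                  ≡⟨ cong (λ i → memᵇ (suc i) (pixPart σ)) (toℕ-fromℕ< 1+q≤n) ⟨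
  memᵇ (suc (toℕ i)) (pixPart σ)            ≡⟨ lookup∘tabulate (λ j → memᵇ (suc (toℕ j)) (pixPart σ)) i ⟨
  lookup (PIX n σ) i
    ≡⟨ cong (λ X → lookup X i) (trans PIX≡A (sym (tabulate-memᵇ-elementsFrom 1 A))) ⟩
  lookup (tabulate (λ j → memᵇ (suc (toℕ j)) as)) i ≡⟨ lookup∘tabulate (λ j → memᵇ (suc (toℕ j)) as) i ⟩
  memᵇ (suc (toℕ i)) as                     ≡⟨ cong (λ i → memᵇ (suc i) as) (toℕ-fromℕ< 1+q≤n) ⟩
  memᵇ (suc q) as                           ∎
  where
  open ≡-Reasoning
  as = elementsFrom 1 A
  i = fromℕ< 1+q≤n

isDesarᵇ-∷ : ∀ x xs → isDesarᵇ (x ∷ xs) ≡ evenᵇ (firstAscent (x ∷ xs))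
isDesarᵇ-∷ x xs with firstAscent (x ∷ xs) | firstAscent-≥1 x xs
... | suc zero    | _ = refl
... | suc (suc k) | _ = ∧-identityʳ (evenᵇ k)

pixPart-++-desPart : ∀ σ → pixPart σ ++ desPart σ ≡ σ
pixPart-++-desPart []       = refl
pixPart-++-desPart (x ∷ xs) with isDesarᵇ (x ∷ xs)
... | true  = refl
... | false = cong (x ∷_) (pixPart-++-desPart xs)

desPart-even : ∀ σ → T (evenᵇ (firstAscent (desPart σ)))
desPart-even []       = _
desPart-even (x ∷ xs) with isDesarᵇ (x ∷ xs) | isDesarᵇ-∷ x xs
... | true  | even = subst T even _
... | false | _    = desPart-even xs

non-desarrangement-ascent : ∀ x y ys →
  isDesarᵇ (x ∷ y ∷ ys) ≡ false → isDesarᵇ (y ∷ ys) ≡ false → x < y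
non-desarrangement-ascent x y ys x∷y∷ys y∷ys rewrite isDesarᵇ-∷ x (y ∷ ys) | isDesarᵇ-∷ y ys
  with x <ᵇ y | <ᵇ-reflects-< x y
... | true  | ofʸ x<y = x<y
... | false | _       rewrite evenᵇ-suc (firstAscent (y ∷ ys)) | y∷ys with () ← x∷y∷ys

pixPart-increasing : ∀ σ → Increasing (pixPart σ)
pixPart-increasing []       = []
pixPart-increasing (x ∷ xs) with isDesarᵇ (x ∷ xs) in x∷xs
... | true  = []
... | false = All.tabulate (x<pix xs x∷xs) ∷ pixPart-increasing xs
  where
  x<pix : ∀ xs → isDesarᵇ (x ∷ xs) ≡ false → ∀ {z} → z ∈ pixPart xs → x < z
  x<pix (y ∷ ys) x∷y∷ys z∈ with isDesarᵇ (y ∷ ys) in y∷ys | pixPart-increasing (y ∷ ys) | z∈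
  ... | false | _          | here refl  = non-desarrangement-ascent x y ys x∷y∷ys y∷ys
  ... | false | y< ∷ _     | there z∈′  =
    <-trans (non-desarrangement-ascent x y ys x∷y∷ys y∷ys) (All.lookup y< z∈′)

increasing-++-even : ∀ a as d → All (a <_) as → T (evenᵇ (firstAscent d)) →
  isDesarᵇ (a ∷ as ++ d) ≡ false
increasing-++-even a (b ∷ as) d (a<b ∷ _) _ rewrite <⇒<ᵇ≡true a<b = refl
increasing-++-even a []       []       _ _ = refl
increasing-++-even a []       (y ∷ ys) _ even with a <ᵇ y
... | true  = refl
... | false rewrite evenᵇ-suc (firstAscent (y ∷ ys)) | T⇒≡true even = refl

pixPart-++ : ∀ as d → Increasing as → T (evenᵇ (firstAscent d)) →
  pixPart (as ++ d) ≡ as × desPart (as ++ d) ≡ d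
pixPart-++ []       []      _          _    = refl , refl
pixPart-++ []       (x ∷ d) _          even rewrite isDesarᵇ-∷ x d | T⇒≡true even = refl , refl
pixPart-++ (a ∷ as) d       (a< ∷ as↑) even rewrite increasing-++-even a as d a< even
  with pix≡ , des≡ ← pixPart-++ as d as↑ even = cong (a ∷_) pix≡ , des≡

countBelow-mono : ∀ {x y} w → x ≤ y → countBelow x w ≤ countBelow y w
countBelow-mono []      _   = z≤n
countBelow-mono {x} {y} (z ∷ w) x≤y with z <ᵇ x | <ᵇ-reflects-< z x | z <ᵇ y | <ᵇ-reflects-< z y
... | true  | _       | true  | _       = s≤s (countBelow-mono w x≤y)
... | true  | ofʸ z<x | false | ofⁿ z≮y = ⊥-elim (z≮y (<-≤-trans z<x x≤y))
... | false | _       | true  | _       = m≤n⇒m≤1+n (countBelow-mono w x≤y)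
... | false | _       | false | _       = countBelow-mono w x≤y

countBelow-strict : ∀ {x y w} → x < y → x ∈ w → suc (countBelow x w) ≤ countBelow y w
countBelow-strict {x} {y} {z ∷ w} x<y (here refl) rewrite ≥⇒<ᵇ≡false {n = x} ≤-refl | <⇒<ᵇ≡true x<y =
  s≤s (countBelow-mono w (<⇒≤ x<y))
countBelow-strict {x} {y} {z ∷ w} x<y (there x∈) with z <ᵇ x | <ᵇ-reflects-< z x | z <ᵇ y | <ᵇ-reflects-< z y
... | true  | _       | true  | _       = s≤s (countBelow-strict x<y x∈)
... | true  | ofʸ z<x | false | ofⁿ z≮y = ⊥-elim (z≮y (<-trans z<x x<y))
... | false | _       | true  | _       = m≤n⇒m≤1+n (countBelow-strict x<y x∈)
... | false | _       | false | _       = countBelow-strict x<y x∈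

countBelow-≤ : ∀ {x w} → All (x ≤_) w → countBelow x w ≡ 0
countBelow-≤ x≤w = cong length (filter-none _ (All.map (λ x≤y y<x → <⇒≱ (<ᵇ⇒< _ _ y<x) x≤y) x≤w))

rank : List ℕ → ℕ → ℕ
rank bs x = suc (countBelow x bs)

rank-monotoneOn : ∀ bs → StrictlyMonotoneOn bs (rank bs)
rank-monotoneOn bs x∈ _ x<y = s≤s (countBelow-strict x<y x∈)

rank-head : ∀ {b bs} → All (b <_) bs → rank (b ∷ bs) b ≡ 1
rank-head b< = cong suc (countBelow-≤ (≤-refl ∷ All.map <⇒≤ b<))

rank-∷ : ∀ {b bs x} → b < x → rank (b ∷ bs) x ≡ suc (rank bs x)
rank-∷ b<x rewrite <⇒<ᵇ≡true b<x = refl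

-- The j-th letter, 1-based; 0 is a junk value outside 1 ≤ j ≤ length.
letterAt : List ℕ → ℕ → ℕ
letterAt []       _             = 0
letterAt (b ∷ bs) zero          = 0
letterAt (b ∷ bs) (suc zero)    = b
letterAt (b ∷ bs) (suc (suc j)) = letterAt bs (suc j)

letterAt-rank : ∀ {bs x} → Increasing bs → x ∈ bs → letterAt bs (rank bs x) ≡ x
letterAt-rank (b< ∷ _)   (here refl) rewrite rank-head b< = refl
letterAt-rank {b ∷ bs} (b< ∷ bs↑) (there x∈) =
  trans (cong (letterAt (b ∷ bs)) (rank-∷ (All.lookup b< x∈))) (letterAt-rank bs↑ x∈)

map-rank : ∀ {bs} → Increasing bs → map (rank bs) bs ≡ interval 1 (length bs)
map-rank []                       = refl
map-rank {b ∷ bs} (b< ∷ bs↑) = cong₂ _∷_ (rank-head b<) (begin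
  map (rank (b ∷ bs)) bs      ≡⟨ map-cong-local (All.map rank-∷ b<) ⟩
  map (suc ∘ rank bs) bs      ≡⟨ map-∘ bs ⟩
  map suc (map (rank bs) bs)  ≡⟨ cong (map suc) (map-rank bs↑) ⟩
  map suc (interval 1 (length bs)) ≡⟨ interval-2≡map-suc (length bs) ⟨
  interval 2 (length bs)      ∎)
  where open ≡-Reasoning

module Standardization {bs : List ℕ} (bs↑ : Increasing bs) where

  relabel : List ℕ → List ℕ
  relabel = map (letterAt bs)

  standardize≡map-rank : ∀ {d} → d ↭ bs → standardize d ≡ map (rank bs) d
  standardize≡map-rank {d} d↭ = map-cong (λ x → cong suc (countBelow-↭ x d↭)) d

  rank-letterAt : ∀ {j} → j ∈ interval 1 (length bs) → rank bs (letterAt bs j) ≡ j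
  rank-letterAt j∈ with x , x∈ , refl ← ∈-map⁻ (rank bs) (subst (_ ∈_) (sym (map-rank bs↑)) j∈) =
    cong (rank bs) (letterAt-rank bs↑ x∈)

  map-letterAt-interval : map (letterAt bs) (interval 1 (length bs)) ≡ bs
  map-letterAt-interval = begin
    map (letterAt bs) (interval 1 (length bs))  ≡⟨ cong (map (letterAt bs)) (map-rank bs↑) ⟨
    map (letterAt bs) (map (rank bs) bs)        ≡⟨ map-∘ bs ⟨
    map (letterAt bs ∘ rank bs) bs              ≡⟨ map-id-local (All.tabulate (letterAt-rank bs↑)) ⟩
    bs                                          ∎
    where open ≡-Reasoning

  standardize-IsPerm : ∀ {d} → d ↭ bs → IsPerm (length bs) (standardize d)
  standardize-IsPerm {d} d↭ = begin
    standardize d      ≡⟨ standardize≡map-rank d↭ ⟩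
    map (rank bs) d    ↭⟨ map⁺-↭ (rank bs) d↭ ⟩
    map (rank bs) bs   ≡⟨ map-rank bs↑ ⟩
    interval 1 (length bs) ∎
    where open PermutationReasoning

  relabel-↭ : ∀ {π} → IsPerm (length bs) π → relabel π ↭ bs
  relabel-↭ π↭ = ↭-trans (map⁺-↭ (letterAt bs) π↭) (↭-reflexive map-letterAt-interval)

  standardize-relabel : ∀ {π} → IsPerm (length bs) π → standardize (relabel π) ≡ π
  standardize-relabel {π} π↭ = begin
    standardize (relabel π)          ≡⟨ standardize≡map-rank (relabel-↭ π↭) ⟩
    map (rank bs) (map (letterAt bs) π) ≡⟨ map-∘ π ⟨
    map (rank bs ∘ letterAt bs) π    ≡⟨ map-id-local (All.tabulate (rank-letterAt ∘ ∈-resp-↭ π↭)) ⟩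
    π                                ∎
    where open ≡-Reasoning

  relabel-standardize : ∀ {d} → d ↭ bs → relabel (standardize d) ≡ d
  relabel-standardize {d} d↭ = begin
    relabel (standardize d)          ≡⟨ cong relabel (standardize≡map-rank d↭) ⟩
    map (letterAt bs) (map (rank bs) d) ≡⟨ map-∘ d ⟨
    map (letterAt bs ∘ rank bs) d    ≡⟨ map-id-local (All.tabulate (letterAt-rank bs↑ ∘ ∈-resp-↭ d↭)) ⟩
    d                                ∎
    where open ≡-Reasoning

  rank-monotoneOn-↭ : ∀ {d} → d ↭ bs → StrictlyMonotoneOn d (rank bs)
  rank-monotoneOn-↭ d↭ x∈ y∈ = rank-monotoneOn bs (∈-resp-↭ d↭ x∈) (∈-resp-↭ d↭ y∈)

  firstAscent-standardize : ∀ {d} → d ↭ bs → firstAscent (standardize d) ≡ firstAscent d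
  firstAscent-standardize {d} d↭ =
    trans (cong firstAscent (standardize≡map-rank d↭)) (firstAscent-map d (rank-monotoneOn-↭ d↭))

  firstAscent-relabel : ∀ {π} → IsPerm (length bs) π → firstAscent (relabel π) ≡ firstAscent π
  firstAscent-relabel π↭ =
    trans (sym (firstAscent-standardize (relabel-↭ π↭))) (cong firstAscent (standardize-relabel π↭))

  inv-standardize : ∀ {d} → d ↭ bs → inv (standardize d) ≡ inv d
  inv-standardize {d} d↭ = trans (cong inv (standardize≡map-rank d↭)) (inv-map d (rank-monotoneOn-↭ d↭))

inv-++-increasing : ∀ {as} d → Increasing as →
  inv (as ++ d) ≡ sum (map (λ a → countBelow a d) as) + inv d
inv-++-increasing d []                        = refl
inv-++-increasing {a ∷ as} d (a< ∷ as↑) = begin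
  countBelow a (as ++ d) + inv (as ++ d)
    ≡⟨ cong₂ _+_ (trans (countBelow-++ a as d) (cong (_+ countBelow a d) (countBelow-≤ (All.map <⇒≤ a<))))
                 (inv-++-increasing d as↑) ⟩
  countBelow a d + (sum (map (λ a → countBelow a d) as) + inv d)
    ≡⟨ +-assoc (countBelow a d) _ (inv d) ⟨
  countBelow a d + sum (map (λ a → countBelow a d) as) + inv d ∎
  where open ≡-Reasoning

rank-interval : ∀ {n w x} → w ↭ interval 1 n → x ∈ w → rank w x ≡ x
rank-interval {n} {x = zero}  w↭ x∈ = ⊥-elim (1+n≰n (proj₁ (∈-interval⁻ 1 n (∈-resp-↭ w↭ x∈))))
rank-interval {n} {x = suc q} w↭ x∈ = cong suc (trans (countBelow-↭ (suc q) w↭)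
  (countBelow-interval q n (<⇒≤ (≤-pred (proj₂ (∈-interval⁻ 1 n (∈-resp-↭ w↭ x∈)))))))

-- A letter a of as has rank a in as ++ d; its rank within as accounts for 1 + ⋯ + |as| in total, and the
-- letters of d below it are exactly its inversions with d.
inv-++-pix : ∀ {n as} d → Increasing as → as ++ d ↭ interval 1 n →
  inv (as ++ d) + sum (interval 1 (length as)) ≡ sum as + inv d
inv-++-pix {n} {as} d as↑ as++d↭ = begin
  inv (as ++ d) + sum (interval 1 (length as))
    ≡⟨ cong₂ _+_ (inv-++-increasing d as↑) (cong sum (sym (map-rank as↑))) ⟩
  (below-d + inv d) + sum (map (rank as) as)    ≡⟨ rearrange below-d (inv d) _ ⟩
  (sum (map (rank as) as) + below-d) + inv d
    ≡⟨ cong (_+ inv d) (sym (sum-map-+ (rank as) (λ a → countBelow a d) as)) ⟩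
  sum (map (λ a → rank as a + countBelow a d) as) + inv d
    ≡⟨ cong (λ w → sum w + inv d) (map-cong (λ a → cong suc (sym (countBelow-++ a as d))) as) ⟩
  sum (map (rank (as ++ d)) as) + inv d
    ≡⟨ cong (λ w → sum w + inv d) (map-id-local {xs = as} (All.tabulate (rank-interval as++d↭ ∘ ∈-++⁺ˡ))) ⟩
  sum as + inv d                                 ∎
  where
  open ≡-Reasoning
  below-d = sum (map (λ a → countBelow a d) as)
  rearrange : ∀ a b c → (a + b) + c ≡ (c + a) + b
  rearrange = solve-∀

-- The fibres of PIX

intEqᵇ⇒≡ : ∀ a b → T (intEqᵇ a b) → a ≡ b
intEqᵇ⇒≡ a b t with a ℤ.≟ b
... | yes a≡b = a≡b

≡⇒intEqᵇ : ∀ {a b} → a ≡ b → T (intEqᵇ a b)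
≡⇒intEqᵇ {a} refl with a ℤ.≟ a
... | yes _  = _
... | no a≢a = a≢a refl

subsetEqᵇ⇒≡ : ∀ {n} (X Y : Subset n) → T (subsetEqᵇ X Y) → X ≡ Y
subsetEqᵇ⇒≡ []          []          _ = refl
subsetEqᵇ⇒≡ (true ∷ X)  (true ∷ Y)  t = cong (true ∷_) (subsetEqᵇ⇒≡ X Y t)
subsetEqᵇ⇒≡ (false ∷ X) (false ∷ Y) t = cong (false ∷_) (subsetEqᵇ⇒≡ X Y t)

subsetEqᵇ-refl : ∀ {n} (X : Subset n) → T (subsetEqᵇ X X)
subsetEqᵇ-refl []          = _
subsetEqᵇ-refl (true ∷ X)  = subsetEqᵇ-refl X
subsetEqᵇ-refl (false ∷ X) = subsetEqᵇ-refl X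

+-≡-offset : ∀ {a S s i} → a + s ≡ S + i → ℤ.+ a ≡ ((ℤ.+ S) ℤ.- (ℤ.+ s)) ℤ.+ (ℤ.+ i)
+-≡-offset {a} {S} {s} {i} a+s≡S+i = begin
  ℤ.+ a                              ≡⟨ cancel (ℤ.+ a) (ℤ.+ s) ⟨
  ((ℤ.+ a) ℤ.+ (ℤ.+ s)) ℤ.- (ℤ.+ s)        ≡⟨ cong (λ x → (ℤ.+ x) ℤ.- (ℤ.+ s)) a+s≡S+i ⟩
  ((ℤ.+ S) ℤ.+ (ℤ.+ i)) ℤ.- (ℤ.+ s)        ≡⟨ regroup (ℤ.+ S) (ℤ.+ s) (ℤ.+ i) ⟨
  ((ℤ.+ S) ℤ.- (ℤ.+ s)) ℤ.+ (ℤ.+ i)        ∎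
  where
  open ≡-Reasoning
  cancel : ∀ x y → (x ℤ.+ y) ℤ.- y ≡ x
  cancel = ℤ-Solver.solve-∀
  regroup : ∀ x y z → (x ℤ.- y) ℤ.+ z ≡ (x ℤ.+ z) ℤ.- y
  regroup = ℤ-Solver.solve-∀

module Fiber {n : ℕ} (A : Subset n) where

  pix↑ : List ℕ
  pix↑ = elementsFrom 1 A

  des↑ : List ℕ
  des↑ = elementsFrom 1 (∁ A)

  |des↑| : ℕ
  |des↑| = length des↑

  open Standardization (elementsFrom-increasing 1 (∁ A))

  offset : ℤ
  offset = (ℤ.+ sum pix↑) ℤ.- (ℤ.+ sum (range1 (length pix↑)))

  pix↑++des↑ : pix↑ ++ des↑ ↭ interval 1 n
  pix↑++des↑ = elementsFrom-∁ 1 A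

  pixPart≡pix↑ : ∀ {σ} → IsPerm n σ → PIX n σ ≡ A → pixPart σ ≡ pix↑
  pixPart≡pix↑ {σ} σ↭ PIX≡A = increasing-≡ (pixPart-increasing σ) (elementsFrom-increasing 1 A) to from
    where
    to : ∀ {z} → z ∈ pixPart σ → z ∈ pix↑
    to z∈ with 1≤z , z≤max ← IsPerm-∈ σ↭ (subst (_ ∈_) (pixPart-++-desPart σ) (∈-++⁺ˡ z∈)) =
      memᵇ⇒∈ pix↑ (trans (sym (memᵇ-PIX {σ = σ} A PIX≡A 1≤z z≤max)) (∈⇒memᵇ z∈))
    from : ∀ {z} → z ∈ pix↑ → z ∈ pixPart σ
    from z∈ with 1≤z , z<1+n ← elementsFrom-bounds 1 A z∈ =
      memᵇ⇒∈ (pixPart σ) (trans (memᵇ-PIX {σ = σ} A PIX≡A 1≤z (≤-pred z<1+n)) (∈⇒memᵇ z∈))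

  PIX≡A : ∀ {σ} → pixPart σ ≡ pix↑ → PIX n σ ≡ A
  PIX≡A pix≡ rewrite pix≡ = tabulate-memᵇ-elementsFrom 1 A

  desPart-↭ : ∀ {σ} → IsPerm n σ → pixPart σ ≡ pix↑ → desPart σ ↭ des↑
  desPart-↭ {σ} σ↭ pix≡ = ++-cancelˡ-↭ pix↑ (begin
    pix↑ ++ desPart σ        ≡⟨ cong (_++ desPart σ) pix≡ ⟨
    pixPart σ ++ desPart σ   ≡⟨ pixPart-++-desPart σ ⟩
    σ                        ↭⟨ σ↭ ⟩
    interval 1 n             ↭⟨ pix↑++des↑ ⟨
    pix↑ ++ des↑             ∎)
    where open PermutationReasoning

  mag-fiber : ∀ {σ} → pixPart σ ≡ pix↑ → mag σ ≡ offset ℤ.+ (ℤ.+ imaj (Desar σ))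
  mag-fiber pix≡ rewrite pix≡ = refl

  invℤ-fiber : ∀ {σ} → IsPerm n σ → pixPart σ ≡ pix↑ → invℤ σ ≡ offset ℤ.+ (ℤ.+ inv (Desar σ))
  invℤ-fiber {σ} σ↭ pix≡ = +-≡-offset (begin
    inv σ + sum (range1 (length pix↑))
      ≡⟨ cong₂ (λ w r → inv w + sum r) σ≡ (range1≡interval (length pix↑)) ⟩
    inv (pix↑ ++ desPart σ) + sum (interval 1 (length pix↑))
      ≡⟨ inv-++-pix (desPart σ) (elementsFrom-increasing 1 A) (subst (_↭ interval 1 n) σ≡ σ↭) ⟩
    sum pix↑ + inv (desPart σ)
      ≡⟨ cong (sum pix↑ +_) (inv-standardize (desPart-↭ σ↭ pix≡)) ⟨
    sum pix↑ + inv (Desar σ) ∎)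
    where
    open ≡-Reasoning
    σ≡ : σ ≡ pix↑ ++ desPart σ
    σ≡ = trans (sym (pixPart-++-desPart σ)) (cong (_++ desPart σ) pix≡)

  Desar-IsPerm : ∀ {σ} → IsPerm n σ → pixPart σ ≡ pix↑ → IsPerm |des↑| (Desar σ)
  Desar-IsPerm σ↭ pix≡ = standardize-IsPerm (desPart-↭ σ↭ pix≡)

  Desar-even : ∀ {σ} → IsPerm n σ → pixPart σ ≡ pix↑ → T (evenᵇ (firstAscent (Desar σ)))
  Desar-even {σ} σ↭ pix≡ =
    subst (T ∘ evenᵇ) (sym (firstAscent-standardize (desPart-↭ σ↭ pix≡))) (desPart-even σ)

  reassemble : List ℕ → List ℕ
  reassemble π = pix↑ ++ relabel π

  reassemble-IsPerm : ∀ {π} → IsPerm |des↑| π → IsPerm n (reassemble π)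
  reassemble-IsPerm π↭ = ↭-trans (++⁺ˡ pix↑ (relabel-↭ π↭)) pix↑++des↑

  reassemble-parts : ∀ {π} → IsPerm |des↑| π → T (evenᵇ (firstAscent π)) →
    pixPart (reassemble π) ≡ pix↑ × desPart (reassemble π) ≡ relabel π
  reassemble-parts {π} π↭ even = pixPart-++ pix↑ (relabel π) (elementsFrom-increasing 1 A)
    (subst (T ∘ evenᵇ) (sym (firstAscent-relabel π↭)) even)

  Desar-reassemble : ∀ {π} → IsPerm |des↑| π → T (evenᵇ (firstAscent π)) → Desar (reassemble π) ≡ π
  Desar-reassemble π↭ even = trans (cong standardize (proj₂ (reassemble-parts π↭ even))) (standardize-relabel π↭)

  reassemble-Desar : ∀ {σ} → IsPerm n σ → pixPart σ ≡ pix↑ → reassemble (Desar σ) ≡ σ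
  reassemble-Desar {σ} σ↭ pix≡ = begin
    pix↑ ++ relabel (standardize (desPart σ))  ≡⟨ cong (pix↑ ++_) (relabel-standardize (desPart-↭ σ↭ pix≡)) ⟩
    pix↑ ++ desPart σ                          ≡⟨ cong (_++ desPart σ) pix≡ ⟨
    pixPart σ ++ desPart σ                     ≡⟨ pixPart-++-desPart σ ⟩
    σ                                          ∎
    where open ≡-Reasoning

  module Count (stat : List ℕ → ℤ) (st : List ℕ → ℕ)
               (stat≡ : ∀ {σ} → IsPerm n σ → pixPart σ ≡ pix↑ → stat σ ≡ offset ℤ.+ (ℤ.+ st (Desar σ)))
               (k : ℤ) where

    hit : ℕ → Bool
    hit v = intEqᵇ (offset ℤ.+ (ℤ.+ v)) k

    inFiber : List ℕ → Bool
    inFiber σ = subsetEqᵇ (PIX n σ) A ∧ intEqᵇ (stat σ) k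

    fiber : List (List ℕ)
    fiber = filterᵇ inFiber (Sn n)

    image : List (List ℕ)
    image = filterᵇ (hit ∘ st) (desarrangements |des↑|)

    ∈-fiber⁻ : ∀ {σ} → σ ∈ fiber → IsPerm n σ × pixPart σ ≡ pix↑ × stat σ ≡ k
    ∈-fiber⁻ σ∈ with σ∈Sn , t ← ∈-filter⁻ (T? ∘ inFiber) σ∈
                with PIX≡ , stat≡k ← Equivalence.to T-∧ t =
      σ↭ , pixPart≡pix↑ σ↭ (subsetEqᵇ⇒≡ _ A PIX≡) , intEqᵇ⇒≡ _ k stat≡k
      where σ↭ = Sn⇒IsPerm n σ∈Sn

    ∈-fiber⁺ : ∀ {σ} → IsPerm n σ → pixPart σ ≡ pix↑ → stat σ ≡ k → σ ∈ fiber
    ∈-fiber⁺ {σ} σ↭ pix≡ stat≡k = ∈-filter⁺ (T? ∘ inFiber) {x = σ} (IsPerm⇒Sn n σ↭)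
      (Equivalence.from (T-∧ {subsetEqᵇ (PIX n σ) A})
        (subst (λ X → T (subsetEqᵇ X A)) (sym (PIX≡A {σ} pix≡)) (subsetEqᵇ-refl A) , ≡⇒intEqᵇ stat≡k))

    ∈-image⁻ : ∀ {π} → π ∈ image →
      IsPerm |des↑| π × T (evenᵇ (firstAscent π)) × offset ℤ.+ (ℤ.+ st π) ≡ k
    ∈-image⁻ π∈ with π∈D , hit≡ ← ∈-filter⁻ (T? ∘ hit ∘ st) π∈
                with π∈perms , even ← ∈-filter⁻ (T? ∘ evenᵇ ∘ firstAscent) π∈D =
      perms⇒IsPerm |des↑| π∈perms , even , intEqᵇ⇒≡ _ k hit≡

    ∈-image⁺ : ∀ {π} → IsPerm |des↑| π → T (evenᵇ (firstAscent π)) → offset ℤ.+ (ℤ.+ st π) ≡ k →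
      π ∈ image
    ∈-image⁺ π↭ even hit≡k = ∈-filter⁺ (T? ∘ hit ∘ st)
      (∈-filter⁺ (T? ∘ evenᵇ ∘ firstAscent) (IsPerm⇒perms |des↑| π↭) even) (≡⇒intEqᵇ hit≡k)

    length-fiber : length fiber ≡ length image
    length-fiber = length-≡-by-inverses Desar reassemble
      (Unique.filter⁺ (T? ∘ inFiber) (Sn-unique n))
      (Unique.filter⁺ (T? ∘ hit ∘ st) (Unique.filter⁺ (T? ∘ evenᵇ ∘ firstAscent) (perms-unique |des↑|)))
      Desar-∈ reassemble-∈ inverseˡ inverseʳ
      where
      Desar-∈ : ∀ {σ} → σ ∈ fiber → Desar σ ∈ image
      Desar-∈ σ∈ with σ↭ , pix≡ , stat≡k ← ∈-fiber⁻ σ∈ =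
        ∈-image⁺ (Desar-IsPerm σ↭ pix≡) (Desar-even σ↭ pix≡) (trans (sym (stat≡ σ↭ pix≡)) stat≡k)
      reassemble-∈ : ∀ {π} → π ∈ image → reassemble π ∈ fiber
      reassemble-∈ π∈ with π↭ , even , hit≡k ← ∈-image⁻ π∈ with pix≡ , _ ← reassemble-parts π↭ even =
        ∈-fiber⁺ (reassemble-IsPerm π↭) pix≡
          (trans (stat≡ (reassemble-IsPerm π↭) pix≡)
                 (trans (cong (λ π → offset ℤ.+ (ℤ.+ st π)) (Desar-reassemble π↭ even)) hit≡k))
      inverseˡ : ∀ {σ} → σ ∈ fiber → reassemble (Desar σ) ≡ σ
      inverseˡ σ∈ with σ↭ , pix≡ , _ ← ∈-fiber⁻ σ∈ = reassemble-Desar σ↭ pix≡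
      inverseʳ : ∀ {π} → π ∈ image → Desar (reassemble π) ≡ π
      inverseʳ π∈ with π↭ , even , _ ← ∈-image⁻ π∈ = Desar-reassemble π↭ even

  count-fiber : ∀ (stat : List ℕ → ℤ) (st : List ℕ → ℕ) →
    (∀ {σ} → IsPerm n σ → pixPart σ ≡ pix↑ → stat σ ≡ offset ℤ.+ (ℤ.+ st (Desar σ))) → ∀ k →
    count n stat A k ≡
    length (filterᵇ (λ v → intEqᵇ (offset ℤ.+ (ℤ.+ v)) k) (map st (desarrangements |des↑|)))
  count-fiber stat st stat≡ k = begin
    length fiber                                          ≡⟨ length-fiber ⟩
    length image                                          ≡⟨ length-map st image ⟨
    length (map st image)
      ≡⟨ cong length (filterᵇ-map hit st (desarrangements |des↑|)) ⟨
    length (filterᵇ hit (map st (desarrangements |des↑|))) ∎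
    where
    open ≡-Reasoning
    open Count stat st stat≡ k

corollary2p7 : (n : ℕ) (A : Subset n) (k : ℤ) →
    count n mag A k ≡ count n invℤ A k
corollary2p7 n A k = begin
  count n mag A k
    ≡⟨ count-fiber mag imaj (λ {σ} _ → mag-fiber {σ}) k ⟩
  length (filterᵇ hit (map imaj (desarrangements |des↑|)))
    ≡⟨ ↭-length (filter-↭ (T? ∘ hit) (imaj-inv-equidistributed |des↑|)) ⟩
  length (filterᵇ hit (map inv (desarrangements |des↑|)))
    ≡⟨ count-fiber invℤ inv invℤ-fiber k ⟨
  count n invℤ A k ∎
  where
  open Fiber A
  open ≡-Reasoning
  hit : ℕ → Bool
  hit v = intEqᵇ (offset ℤ.+ (ℤ.+ v)) k
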